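{- For every $n\ge2$, $$t\,A_{n-1}(t)=\sum_{2\le 2k\le n}c_{n,k}\,t^k(1+t)^{n-2k}.$$ Moreover, for every $p\ge1$, $A_{2p}(-1)=0$ and $(-1)^{p-1}A_{2p-1}(-1)=|\mathcal T_{2p-1}|$.
   Context: $\mathfrak S_n$ is the symmetric group on $[n]=\{1,\dots,n\}$; $A_n(t)=\sum_{\sigma\in\mathfrak S_n}t^{|\{k:\sigma(k)>k\}|}$ for $n\ge1$ (Eulerian polynomials). $\mathcal T_n$ (alternating permutations) is the set of $\sigma\in\mathfrak S_n$ with $\sigma(2j)<\sigma(2j-1)$ and $\sigma(2j)<\sigma(2j+1)$ for all $j$ with $2\le 2j\le n-1$, and additionally $\sigma(n)<\sigma(n-1)$ if $n$ is even. For $\sigma\in\mathfrak S_n'=\{\sigma\in\mathfrak S_n:\sigma(1)=n\}$, set $\sigma(n+1)=n$ and define the word $V(\sigma)=v_1\cdots v_n$ over $\{m,\bar m,d,\bar d\}$ by: $v_j\in\{d,\bar d\}$ if $\sigma(j)>\sigma(j+1)$, $v_j\in\{m,\bar m\}$ if $\sigma(j)<\sigma(j+1)$; for $v_j\in\{d,\bar d\}$ ($j\le n-1$), $v_j=d$ iff $v_{j+1}\in\{d,\bar d\}$, else $\bar d$; for $v_j\in\{m,\bar m\}$ ($j\ge2$), $v_j=m$ iff $v_{j-1}\in\{m,\bar m\}$, else $\bar m$. The integers $c_{n,k}$ are the unique integers such that $\sum_{\sigma\in\mathfrak S_n'}\alpha V(\sigma)=\sum_{2\le2k\le n}c_{n,k}(\bar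 d\bar m)^k(d+m)^{n-2k}$ in $\mathbb Z[m,\bar m,d,\bar d]$, where $\alpha$ maps a word to its commutative monomial (such an expansion exists). -}

module Defs where

open import Data.Bool using (Bool; true; false; _∧_; not; if_then_else_)
open import Data.Nat using (ℕ; zero; suc; _∸_; _≡ᵇ_; _<ᵇ_; _≤ᵇ_) renaming (_*_ to _*ℕ_)
open import Data.List using (List; []; _∷_; [_]; map; concatMap; filterᵇ; foldr; length; upTo)
open import Data.Bool.ListAction using (any; all)
open import Data.Integer using (ℤ; +_; _+_; _*_; _^_)

range1 : ℕ → List ℕ
range1 n = map suc (upTo n)

sumℤ : List ℤ → ℤ
sumℤ = foldr _+_ (+ 0)

prodℤ : List ℤ → ℤ
prodℤ = foldr _*_ (+ 1)

-- 1-based lookup σ(i) of a word σ = σ(1) σ(2) ... ; default 0 outside [1..length]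
at : List ℕ → ℕ → ℕ
at []       _             = 0
at (x ∷ xs) zero          = 0
at (x ∷ xs) (suc zero)    = x
at (x ∷ xs) (suc (suc i)) = at xs (suc i)

words : ℕ → ℕ → List (List ℕ)
words n zero    = [ [] ]
words n (suc m) = concatMap (λ w → map (λ x → x ∷ w) (range1 n)) (words n m)

distinct : List ℕ → Bool
distinct []       = true
distinct (x ∷ xs) = not (any (λ y → x ≡ᵇ y) xs) ∧ distinct xs

evenᵇ : ℕ → Bool
evenᵇ zero          = true
evenᵇ (suc zero)    = false
evenᵇ (suc (suc n)) = evenᵇ n

-- The symmetric group 𝔖ₙ: a permutation σ of [n] is represented by its
-- one-line notation σ(1) … σ(n), i.e. an injective word of length n over [n].

Sym : ℕ → List (List ℕ)
Sym n = filterᵇ distinct (words n n)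

exc : ℕ → List ℕ → ℕ
exc n σ = length (filterᵇ (λ k → k <ᵇ at σ k) (range1 n))

A : ℕ → ℤ → ℤ
A n t = sumℤ (map (λ σ → t ^ exc n σ) (Sym n))

isAlt : ℕ → List ℕ → Bool
isAlt n σ =
  all (λ j → if (2 *ℕ j ≤ᵇ n ∸ 1)
             then ((at σ (2 *ℕ j) <ᵇ at σ (2 *ℕ j ∸ 1)) ∧ (at σ (2 *ℕ j) <ᵇ at σ (suc (2 *ℕ j))))
             else true)
      (range1 n)
  ∧ (if evenᵇ n then at σ n <ᵇ at σ (n ∸ 1) else true)

Alt : ℕ → List (List ℕ)
Alt n = filterᵇ (isAlt n) (Sym n)

Sym' : ℕ → List (List ℕ)
Sym' n = filterᵇ (λ σ → at σ 1 ≡ᵇ n) (Sym n)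

data Letter : Set where
  m m̄ d d̄ : Letter

ext : ℕ → List ℕ → ℕ → ℕ
ext n σ j = if j ≡ᵇ suc n then n else at σ j

desc : ℕ → List ℕ → ℕ → Bool
desc n σ j = ext n σ (suc j) <ᵇ ext n σ j

-- the j-th letter v_j of V(σ), 1 ≤ j ≤ n
-- (the cases "descent at j = n" and "ascent at j = 1", on which the definition
--  is silent, never occur for σ ∈ 𝔖'ₙ with n ≥ 2; we default them to d̄ / m̄)
letter : ℕ → List ℕ → ℕ → Letter
letter n σ j =
  if desc n σ j
  then (if (suc j ≤ᵇ n) ∧ desc n σ (suc j) then d else d̄)
  else (if (2 ≤ᵇ j) ∧ not (desc n σ (j ∸ 1)) then m else m̄)

V : ℕ → List ℕ → List Letter
V n σ = map (letter n σ) (range1 n)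

-- α : word ↦ commutative monomial, evaluated at (m, m̄, d, d̄) = (M, M̄, D, D̄) ∈ ℤ⁴
evalLetter : ℤ → ℤ → ℤ → ℤ → Letter → ℤ
evalLetter M M̄ D D̄ m = M
evalLetter M M̄ D D̄ m̄ = M̄
evalLetter M M̄ D D̄ d = D
evalLetter M M̄ D D̄ d̄ = D̄

α : ℤ → ℤ → ℤ → ℤ → List Letter → ℤ
α M M̄ D D̄ w = prodℤ (map (evalLetter M M̄ D D̄) w)

sumK : ℕ → (ℕ → ℤ) → ℤ
sumK n f = sumℤ (map f (filterᵇ (λ k → 2 *ℕ k ≤ᵇ n) (range1 n)))

-- c = (c_{n,k})_k satisfies the defining expansion
--   Σ_{σ ∈ 𝔖'ₙ} α V(σ) = Σ_{2 ≤ 2k ≤ n} c_{n,k} (d̄ m̄)^k (d + m)^{n-2k}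
-- in ℤ[m, m̄, d, d̄]  (stated as an identity of polynomial functions on ℤ⁴,
-- which is equivalent to the identity of polynomials since ℤ is infinite)
IsExpansion : ℕ → (ℕ → ℤ) → Set
IsExpansion n c =
  ∀ (M M̄ D D̄ : ℤ) →
    sumℤ (map (λ σ → α M M̄ D D̄ (V n σ)) (Sym' n))
      ≡ sumK n (λ k → c k * (D̄ * M̄) ^ k * (D + M) ^ (n ∸ 2 *ℕ k))
  where open import Relation.Binary.PropositionalEquality using (_≡_)

-- Evaluating αV(σ) at m = m̄ = t, d = d̄ = 1 gives t to the number of non-descents of the
-- word σ(1) … σ(n) σ(n+1); for σ = n τ this is t^(1 + asc τ), while the right-hand side of
-- the expansion becomes Σ c_{n,k} t^k (1+t)^(n-2k).  So the first claim says that ascents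
-- are distributed on 𝔖ₙ₋₁ like excedances.  Both statistics obey the Eulerian recurrence:
-- summing g(stat) over 𝔖ₙ₊₁ gives the sum over 𝔖ₙ of (k+1) g(k) + (n-k) g(k+1) at
-- k = stat, by inserting n+1 into the word (ascents) or into the cycle structure
-- (excedances).
--
-- Hence Aₙ(-1) = Σ (-1)^asc σ.  Cut σ = a μ b at its minimum μ.  Reversing a if |a| is even
-- and positive, else reversing b if |b| is, else exchanging a and b if one of them is empty,
-- else recursing into a (or into b when a is fixed) is an involution.  It changes the parity
-- of asc except at its fixed points, which are exactly the down-up permutations; these have
-- odd length 2p-1 and p-1 ascents.

{-# OPTIONS --safe #-}
module Submission where

open import Defs
open import Data.Bool using (Bool; true; false; T; not; _∧_; _∨_; if_then_else_)
open import Data.Bool.ListAction using (any; all)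
open import Data.Bool.Properties using (T-≡; T-∧; ∨-comm; not-involutive; ∧-identityʳ)
open import Data.Empty using (⊥-elim)
open import Data.Integer as ℤ using (ℤ; +_; -1ℤ; -_; _+_; _*_; _^_)
import Data.Integer.Properties as ℤ
import Data.Integer.Tactic.RingSolver as ℤ-Solver
open import Data.List
  using (List; []; _∷_; [_]; _++_; _∷ʳ_; initLast; _∷ʳ′_; drop; map; concatMap; filter; filterᵇ; length; reverse; upTo)
open import Data.List.Membership.Propositional using (_∈_; _∉_; find; lose)
import Data.List.Membership.Propositional.Properties as ∈
open import Data.List.Membership.Propositional.Properties.WithK using (unique∧set⇒bag)
open import Data.List.Properties
  using ( ≡-dec; ∷-injectiveˡ; ∷-injectiveʳ; ∷ʳ-injective; ∷ʳ-injectiveʳ; ++-assoc; ++-cancelˡ; ++-cancelʳ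
        ; length-++; length-++-sucʳ; length-map; length-reverse; length-upTo; map-++; map-∘; map-cong; map-upTo
        ; reverse-involutive; unfold-reverse; filter-++; filter-all; filter-none; filter-reject )
open import Data.List.Relation.Binary.BagAndSetEquality using (∼bag⇒↭)
open import Data.List.Relation.Binary.Permutation.Propositional
  using (_↭_; ↭⇒↭ₛ; ↭-refl; ↭-sym; ↭-trans; ↭-prep; ↭-reflexive)
import Data.List.Relation.Binary.Permutation.Propositional.Properties as ↭
import Data.List.Relation.Binary.Permutation.Setoid.Properties as ↭ₛ
open import Data.List.Relation.Unary.All as All using (All; []; _∷_)
import Data.List.Relation.Unary.All.Properties as All
open import Data.List.Relation.Unary.Any using (here; there)
open import Data.List.Relation.Unary.Unique.Propositional using (Unique; []; _∷_)
import Data.List.Relation.Unary.Unique.Propositional.Properties as Unique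
open import Data.Nat as ℕ using (ℕ; zero; suc; _∸_; _≤_; _<_; z≤n; s≤s; _≡ᵇ_; _<ᵇ_; _≤ᵇ_)
  renaming (_+_ to _+ℕ_; _*_ to _*ℕ_)
import Data.Nat.Properties as ℕ
import Data.Nat.Tactic.RingSolver as ℕ-Solver
open import Data.List.Membership.DecPropositional ℕ._≟_ using (_∈?_)
open import Data.Product as Product using (∃-syntax; _×_; _,_; proj₁; proj₂)
open import Data.Sum using (_⊎_; inj₁; inj₂)
open import Function using (_∘_; _⇔_; mk⇔; case_of_)
open Function.Equivalence using (to; from)
open import Function.Properties.Equivalence using () renaming (trans to ⇔-trans)
import Relation.Binary.PropositionalEquality as Eq
open import Relation.Binary.PropositionalEquality
  using (_≡_; _≢_; refl; sym; trans; cong; cong₂; subst; subst₂; module ≡-Reasoning)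
open import Relation.Binary.Definitions using (tri<; tri≈; tri>)
open import Relation.Nullary using (Dec; yes; no; ¬_; ¬?; does)
open import Relation.Nullary.Decidable using (T?)

private variable
  X Y : Set

x+[y+z]≡y+[x+z] : ∀ a b c → a + (b + c) ≡ b + (a + c)
x+[y+z]≡y+[x+z] = ℤ-Solver.solve-∀

∑ : (X → ℤ) → List X → ℤ
∑ F xs = sumℤ (map F xs)

∑-++ : (F : X → ℤ) (xs ys : List X) → ∑ F (xs ++ ys) ≡ ∑ F xs + ∑ F ys
∑-++ F [] ys = sym (ℤ.+-identityˡ _)
∑-++ F (x ∷ xs) ys = trans (cong (_+_ (F x)) (∑-++ F xs ys)) (sym (ℤ.+-assoc (F x) _ _))

∑-↭ : (F : X → ℤ) {xs ys : List X} → xs ↭ ys → ∑ F xs ≡ ∑ F ys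
∑-↭ F p = ↭ₛ.foldr-commMonoid ℤ.≡-setoid ℤ.+-0-isCommutativeMonoid (↭⇒↭ₛ (↭.map⁺ F p))

∑-cong : {F G : X → ℤ} (xs : List X) → (∀ {x} → x ∈ xs → F x ≡ G x) → ∑ F xs ≡ ∑ G xs
∑-cong [] _ = refl
∑-cong (x ∷ xs) F≡G = cong₂ _+_ (F≡G (here refl)) (∑-cong xs (F≡G ∘ there))

∑-map : (F : Y → ℤ) (f : X → Y) (xs : List X) → ∑ F (map f xs) ≡ ∑ (F ∘ f) xs
∑-map F f [] = refl
∑-map F f (x ∷ xs) = cong (_+_ (F (f x))) (∑-map F f xs)

∑-concatMap : (F : Y → ℤ) (f : X → List Y) (xs : List X) →
              ∑ F (concatMap f xs) ≡ ∑ (∑ F ∘ f) xs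
∑-concatMap F f [] = refl
∑-concatMap F f (x ∷ xs) = trans (∑-++ F (f x) _) (cong (_+_ (∑ F (f x))) (∑-concatMap F f xs))

*-distribˡ-∑ : (c : ℤ) (F : X → ℤ) (xs : List X) → c * ∑ F xs ≡ ∑ (λ x → c * F x) xs
*-distribˡ-∑ c F [] = ℤ.*-zeroʳ c
*-distribˡ-∑ c F (x ∷ xs) = trans (ℤ.*-distribˡ-+ c (F x) _) (cong (_+_ (c * F x)) (*-distribˡ-∑ c F xs))

neg-distrib-∑ : (F : X → ℤ) (xs : List X) → ∑ (-_ ∘ F) xs ≡ - ∑ F xs
neg-distrib-∑ F [] = refl
neg-distrib-∑ F (x ∷ xs) = trans (cong (_+_ (- F x)) (neg-distrib-∑ F xs)) (sym (ℤ.neg-distrib-+ (F x) _))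

∑-filter : {P : X → Set} (P? : ∀ x → Dec (P x)) (F : X → ℤ) (xs : List X) →
           ∑ F xs ≡ ∑ F (filter P? xs) + ∑ F (filter (¬? ∘ P?) xs)
∑-filter P? F [] = refl
∑-filter P? F (x ∷ xs) with P? x
... | yes _ = trans (cong (_+_ (F x)) (∑-filter P? F xs)) (sym (ℤ.+-assoc (F x) _ _))
... | no _ = trans (cong (_+_ (F x)) (∑-filter P? F xs)) (x+[y+z]≡y+[x+z] (F x) (∑ F (filter P? xs)) _)

∑-one : (xs : List X) → ∑ (λ _ → + 1) xs ≡ + length xs
∑-one [] = refl
∑-one (x ∷ xs) = cong (_+_ (+ 1)) (∑-one xs)

∈-delete : ∀ {z x : X} ys₁ ys₂ → z ∈ ys₁ ++ x ∷ ys₂ → z ≢ x → z ∈ ys₁ ++ ys₂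
∈-delete [] ys₂ (here z≡x) z≢x = ⊥-elim (z≢x z≡x)
∈-delete [] ys₂ (there z∈) _ = z∈
∈-delete (y ∷ ys₁) ys₂ (here z≡y) _ = here z≡y
∈-delete (y ∷ ys₁) ys₂ (there z∈) z≢x = there (∈-delete ys₁ ys₂ z∈ z≢x)

unique⊆⇒length≤ : {xs ys : List X} → Unique xs → (∀ {z} → z ∈ xs → z ∈ ys) → length xs ≤ length ys
unique⊆⇒length≤ [] _ = z≤n
unique⊆⇒length≤ {xs = x ∷ xs} (x≢xs ∷ u) xs⊆ys with ∈.∈-∃++ (xs⊆ys (here refl))
... | ys₁ , ys₂ , refl =
  ℕ.≤-trans (s≤s (unique⊆⇒length≤ u xs⊆ys₁++ys₂)) (ℕ.≤-reflexive (sym (length-++-sucʳ ys₁ x ys₂)))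
  where
  xs⊆ys₁++ys₂ : ∀ {z} → z ∈ xs → z ∈ ys₁ ++ ys₂
  xs⊆ys₁++ys₂ z∈ = ∈-delete ys₁ ys₂ (xs⊆ys (there z∈)) (λ z≡x → All.lookup x≢xs z∈ (sym z≡x))

Unique-++⁻ : ∀ (xs : List X) {ys} → Unique (xs ++ ys) → Unique xs × Unique ys
Unique-++⁻ [] u = [] , u
Unique-++⁻ (x ∷ xs) (x≢ ∷ u) = Product.map₁ (All.++⁻ˡ xs x≢ ∷_) (Unique-++⁻ xs u)

Unique-resp-↭ : ∀ {xs ys : List X} → xs ↭ ys → Unique xs → Unique ys
Unique-resp-↭ p = ↭ₛ.Unique-resp-↭ (Eq.setoid _) (↭⇒↭ₛ p)

unique-mid⇒∉ : ∀ {x : X} ys zs → Unique (ys ++ x ∷ zs) → x ∉ ys ++ zs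
unique-mid⇒∉ ys zs u = Unique.Unique[x∷xs]⇒x∉xs (Unique-resp-↭ (↭.shift _ ys zs) u)

shift-∷ʳ : ∀ (x : X) ys zs v → (ys ++ x ∷ zs) ∷ʳ v ↭ x ∷ ys ++ v ∷ zs
shift-∷ʳ x ys zs v = ↭-trans (↭-reflexive (++-assoc ys (x ∷ zs) [ v ]))
  (↭-trans (↭.shift x ys (zs ∷ʳ v)) (↭-prep x (↭.++⁺ˡ ys (↭-sym (↭.∷↭∷ʳ v zs)))))

concatMap-unique : (f : X → List Y) {xs : List X} → Unique xs → (∀ {x} → x ∈ xs → Unique (f x)) →
                   (∀ {x x′ y} → x ∈ xs → x′ ∈ xs → y ∈ f x → y ∈ f x′ → x ≡ x′) →
                   Unique (concatMap f xs)
concatMap-unique f {[]} [] _ _ = []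
concatMap-unique f {x ∷ xs} (x≢xs ∷ u) uf same =
  Unique.++⁺ (uf (here refl)) (concatMap-unique f u (uf ∘ there) (λ p q → same (there p) (there q))) disjoint
  where
  disjoint : ∀ {y} → ¬ (y ∈ f x × y ∈ concatMap f xs)
  disjoint (y∈fx , y∈rest) with find (∈.∈-concatMap⁻ f y∈rest)
  ... | x′ , x′∈xs , y∈fx′ = All.lookup x≢xs x′∈xs (same (here refl) (there x′∈xs) y∈fx y∈fx′)

filter-cong-∈ : ∀ {P Q : X → Set} (P? : ∀ x → Dec (P x)) (Q? : ∀ x → Dec (Q x)) xs →
                (∀ {x} → x ∈ xs → P x ⇔ Q x) → filter P? xs ≡ filter Q? xs
filter-cong-∈ P? Q? [] _ = refl
filter-cong-∈ P? Q? (x ∷ xs) P⇔Q with P? x | Q? x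
... | yes _  | yes _  = cong (x ∷_) (filter-cong-∈ P? Q? xs (P⇔Q ∘ there))
... | yes px | no ¬qx = ⊥-elim (¬qx (to (P⇔Q (here refl)) px))
... | no ¬px | yes qx = ⊥-elim (¬px (from (P⇔Q (here refl)) qx))
... | no _   | no _   = filter-cong-∈ P? Q? xs (P⇔Q ∘ there)

∑-fibres : (F : Y → ℤ) (r : Y → X) (fibre : X → List Y) {xs : List X} {ys : List Y} →
           Unique xs → Unique ys → (∀ {x} → x ∈ xs → Unique (fibre x)) →
           (∀ {x y} → x ∈ xs → y ∈ fibre x → y ∈ ys × r y ≡ x) →
           (∀ {y} → y ∈ ys → r y ∈ xs × y ∈ fibre (r y)) →
           ∑ F ys ≡ ∑ (∑ F ∘ fibre) xs
∑-fibres F r fibre {xs} {ys} uxs uys ufibre into onto =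
  trans (∑-↭ F (↭-sym concat↭ys)) (∑-concatMap F fibre xs)
  where
  concat⊆ys : ∀ {y} → y ∈ concatMap fibre xs → y ∈ ys
  concat⊆ys y∈ with find (∈.∈-concatMap⁻ fibre y∈)
  ... | _ , x∈xs , y∈fibre = proj₁ (into x∈xs y∈fibre)
  ys⊆concat : ∀ {y} → y ∈ ys → y ∈ concatMap fibre xs
  ys⊆concat y∈ys = ∈.∈-concatMap⁺ fibre (lose (proj₁ (onto y∈ys)) (proj₂ (onto y∈ys)))
  concat↭ys : concatMap fibre xs ↭ ys
  concat↭ys = ∼bag⇒↭ (unique∧set⇒bag
    (concatMap-unique fibre uxs ufibre
      (λ x∈ x′∈ y∈ y∈′ → trans (sym (proj₂ (into x∈ y∈))) (proj₂ (into x′∈ y∈′))))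
    uys (mk⇔ concat⊆ys ys⊆concat))

∑-bijection : (F : Y → ℤ) (h : X → Y) (k : Y → X) {xs : List X} {ys : List Y} →
              Unique xs → Unique ys → (∀ {x} → x ∈ xs → h x ∈ ys) → (∀ {y} → y ∈ ys → k y ∈ xs) →
              (∀ {x} → x ∈ xs → k (h x) ≡ x) → (∀ {y} → y ∈ ys → h (k y) ≡ y) →
              ∑ F ys ≡ ∑ (F ∘ h) xs
∑-bijection F h k {xs} uxs uys h∈ k∈ kh hk =
  trans (∑-fibres F k ([_] ∘ h) uxs uys (λ _ → [] ∷ [])
          (λ { x∈ (here refl) → h∈ x∈ , kh x∈ })
          (λ y∈ → k∈ y∈ , here (sym (hk y∈))))
        (∑-cong xs (λ _ → ℤ.+-identityʳ _))

i≡-i⇒i≡0 : ∀ {i} → i ≡ - i → i ≡ + 0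
i≡-i⇒i≡0 {+ zero} _ = refl
i≡-i⇒i≡0 {+ suc _} ()
i≡-i⇒i≡0 {ℤ.-[1+ _ ]} ()

∑-signReversingInvolution :
  (ι : X → X) (fixed? : ∀ x → Dec (ι x ≡ x)) (F : X → ℤ) {xs : List X} → Unique xs →
  (∀ {x} → x ∈ xs → ι x ∈ xs) → (∀ {x} → x ∈ xs → ι (ι x) ≡ x) →
  (∀ {x} → x ∈ xs → ι x ≢ x → F (ι x) ≡ - F x) →
  ∑ F xs ≡ ∑ F (filter fixed? xs)
∑-signReversingInvolution ι fixed? F {xs} u ι∈ ιι reverses =
  trans (∑-filter fixed? F xs) (trans (cong (_+_ (∑ F (filter fixed? xs))) ∑moved≡0) (ℤ.+-identityʳ _))
  where
  moved = filter (¬? ∘ fixed?) xs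
  moved⁻ : ∀ {x} → x ∈ moved → x ∈ xs × ι x ≢ x
  moved⁻ = ∈.∈-filter⁻ (¬? ∘ fixed?)
  ι∈moved : ∀ {x} → x ∈ moved → ι x ∈ moved
  ι∈moved x∈ with moved⁻ x∈
  ... | x∈xs , ιx≢x = ∈.∈-filter⁺ (¬? ∘ fixed?) (ι∈ x∈xs) (λ ιιx≡ιx → ιx≢x (trans (sym ιιx≡ιx) (ιι x∈xs)))
  ιι-moved : ∀ {x} → x ∈ moved → ι (ι x) ≡ x
  ιι-moved = ιι ∘ proj₁ ∘ moved⁻
  ∑moved≡0 : ∑ F moved ≡ + 0
  ∑moved≡0 = i≡-i⇒i≡0 (begin
    ∑ F moved         ≡⟨ ∑-bijection F ι ι umoved umoved ι∈moved ι∈moved ιι-moved ιι-moved ⟩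
    ∑ (F ∘ ι) moved   ≡⟨ ∑-cong moved (λ x∈ → reverses (proj₁ (moved⁻ x∈)) (proj₂ (moved⁻ x∈))) ⟩
    ∑ (-_ ∘ F) moved  ≡⟨ neg-distrib-∑ F moved ⟩
    - ∑ F moved       ∎)
    where
    open ≡-Reasoning
    umoved = Unique.filter⁺ (¬? ∘ fixed?) u

true≢false : true ≢ false
true≢false ()

bit : Bool → ℕ
bit true  = 1
bit false = 0

bit≤1 : ∀ b → bit b ≤ 1
bit≤1 true  = ℕ.≤-refl
bit≤1 false = z≤n

≤ᵇ-true : ∀ {x y} → x ≤ y → (x ≤ᵇ y) ≡ true
≤ᵇ-true x≤y = to T-≡ (ℕ.≤⇒≤ᵇ x≤y)

<ᵇ-true : ∀ {x y} → x < y → (x <ᵇ y) ≡ true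
<ᵇ-true x<y = to T-≡ (ℕ.<⇒<ᵇ x<y)

≤ᵇ-false : ∀ {x y} → y < x → (x ≤ᵇ y) ≡ false
≤ᵇ-false {x} {y} y<x with x ≤ᵇ y in eq
... | false = refl
... | true = ⊥-elim (ℕ.<⇒≱ y<x (ℕ.≤ᵇ⇒≤ x y (subst T (sym eq) _)))

<ᵇ-false : ∀ {x y} → y ≤ x → (x <ᵇ y) ≡ false
<ᵇ-false {x} {y} y≤x with x <ᵇ y in eq
... | false = refl
... | true = ⊥-elim (ℕ.<⇒≱ (ℕ.<ᵇ⇒< x y (subst T (sym eq) _)) y≤x)

not-<ᵇ : ∀ x y → not (y <ᵇ x) ≡ (x ≤ᵇ y)
not-<ᵇ zero y = refl
not-<ᵇ (suc x) zero = refl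
not-<ᵇ (suc x) (suc y) = trans (not-<ᵇ x y) (≤ᵇ≡<ᵇsuc x y)
  where
  ≤ᵇ≡<ᵇsuc : ∀ x y → (x ≤ᵇ y) ≡ (x <ᵇ suc y)
  ≤ᵇ≡<ᵇsuc zero y = refl
  ≤ᵇ≡<ᵇsuc (suc x) y = refl

count : (ℕ → Bool) → List ℕ → ℕ
count p xs = length (filterᵇ p xs)

count-∷ : ∀ p x xs → count p (x ∷ xs) ≡ bit (p x) +ℕ count p xs
count-∷ p x xs with p x
... | true  = refl
... | false = refl

count-map : ∀ p f xs → count p (map f xs) ≡ count (p ∘ f) xs
count-map p f [] = refl
count-map p f (x ∷ xs) = trans (count-∷ p (f x) (map f xs))
  (trans (cong (bit (p (f x)) +ℕ_) (count-map p f xs)) (sym (count-∷ (p ∘ f) x xs)))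

count-cong : ∀ {p q} xs → (∀ {x} → x ∈ xs → p x ≡ q x) → count p xs ≡ count q xs
count-cong {p} {q} [] _ = refl
count-cong {p} {q} (x ∷ xs) p≡q = trans (count-∷ p x xs)
  (trans (cong₂ (λ b c → bit b +ℕ c) (p≡q (here refl)) (count-cong xs (p≡q ∘ there))) (sym (count-∷ q x xs)))

InRange : ℕ → ℕ → Set
InRange n x = 1 ≤ x × x ≤ n

∈-range1⁺ : ∀ {n x} → InRange n x → x ∈ range1 n
∈-range1⁺ {x = suc i} (_ , i<n) = ∈.∈-map⁺ suc (∈.∈-upTo⁺ i<n)

∈-range1⁻ : ∀ {n x} → x ∈ range1 n → InRange n x
∈-range1⁻ x∈ with ∈.∈-map⁻ suc x∈
... | _ , i∈ , refl = s≤s z≤n , ∈.∈-upTo⁻ i∈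

range1-unique : ∀ n → Unique (range1 n)
range1-unique n = Unique.map⁺ ℕ.suc-injective (Unique.upTo⁺ n)

length-range1 : ∀ n → length (range1 n) ≡ n
length-range1 n = trans (length-map suc (upTo n)) (length-upTo n)

range1-suc : ∀ n → range1 (suc n) ≡ 1 ∷ map suc (range1 n)
range1-suc n = cong (λ l → 1 ∷ map suc l) (sym (map-upTo suc n))

count-range1-suc : ∀ p n → count p (range1 (suc n)) ≡ bit (p 1) +ℕ count (p ∘ suc) (range1 n)
count-range1-suc p n = trans (cong (count p) (range1-suc n))
  (trans (count-∷ p 1 _) (cong (bit (p 1) +ℕ_) (count-map p suc (range1 n))))

∈-words⁻ : ∀ n k {w} → w ∈ words n k → length w ≡ k × All (InRange n) w
∈-words⁻ n zero (here refl) = refl , []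
∈-words⁻ n (suc k) w∈ with find (∈.∈-concatMap⁻ _ {xs = words n k} w∈)
... | v , v∈ , xv∈ with ∈.∈-map⁻ (_∷ v) xv∈ | ∈-words⁻ n k v∈
... | x , x∈ , refl | length≡ , inRange = cong suc length≡ , ∈-range1⁻ x∈ ∷ inRange

∈-words⁺ : ∀ n k {w} → length w ≡ k → All (InRange n) w → w ∈ words n k
∈-words⁺ n zero {[]} refl [] = here refl
∈-words⁺ n (suc k) {x ∷ w} length≡ (x∈ ∷ w∈) =
  ∈.∈-concatMap⁺ _ (lose (∈-words⁺ n k (ℕ.suc-injective length≡) w∈) (∈.∈-map⁺ (_∷ w) (∈-range1⁺ x∈)))

words-unique : ∀ n k → Unique (words n k)
words-unique n zero = [] ∷ []
words-unique n (suc k) = concatMap-unique _ (words-unique n k)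
  (λ _ → Unique.map⁺ ∷-injectiveˡ (range1-unique n))
  (λ _ _ y∈ y∈′ → same-tail y∈ y∈′)
  where
  same-tail : ∀ {v v′ y} → y ∈ map (_∷ v) (range1 n) → y ∈ map (_∷ v′) (range1 n) → v ≡ v′
  same-tail y∈ y∈′ with ∈.∈-map⁻ _ y∈ | ∈.∈-map⁻ _ y∈′
  ... | _ , _ , refl | _ , _ , eq = ∷-injectiveʳ eq

x∉⇒¬any : ∀ {x} {ys} → All (x ≢_) ys → T (not (any (x ≡ᵇ_) ys))
x∉⇒¬any [] = _
x∉⇒¬any {x} {y ∷ ys} (x≢y ∷ x≢ys) with x ≡ᵇ y in eq
... | true = x≢y (ℕ.≡ᵇ⇒≡ x y (subst T (sym eq) _))
... | false = x∉⇒¬any x≢ys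

¬any⇒x∉ : ∀ {x} ys → T (not (any (x ≡ᵇ_) ys)) → All (x ≢_) ys
¬any⇒x∉ [] _ = []
¬any⇒x∉ {x} (y ∷ ys) with x ≡ᵇ y in eq
... | true = λ ()
... | false = λ ¬any → (λ x≡y → subst T eq (ℕ.≡⇒≡ᵇ x y x≡y)) ∷ ¬any⇒x∉ ys ¬any

unique⇒distinct : ∀ {xs} → Unique xs → T (distinct xs)
unique⇒distinct [] = _
unique⇒distinct (x≢xs ∷ u) = from T-∧ (x∉⇒¬any x≢xs , unique⇒distinct u)

distinct⇒unique : ∀ xs → T (distinct xs) → Unique xs
distinct⇒unique [] _ = []
distinct⇒unique (x ∷ xs) dist with to T-∧ dist
... | ¬any , dist′ = ¬any⇒x∉ xs ¬any ∷ distinct⇒unique xs dist′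

record IsPerm (n : ℕ) (σ : List ℕ) : Set where
  field
    length≡ : length σ ≡ n
    inRange : All (InRange n) σ
    unique  : Unique σ

open IsPerm

∈-Sym⁻ : ∀ n {σ} → σ ∈ Sym n → IsPerm n σ
∈-Sym⁻ n σ∈ with ∈.∈-filter⁻ (T? ∘ distinct) σ∈
... | σ∈words , dist with ∈-words⁻ n n σ∈words
... | length≡ , inRange = record { length≡ = length≡ ; inRange = inRange ; unique = distinct⇒unique _ dist }

∈-Sym⁺ : ∀ n {σ} → IsPerm n σ → σ ∈ Sym n
∈-Sym⁺ n p = ∈.∈-filter⁺ (T? ∘ distinct) (∈-words⁺ n n (length≡ p) (inRange p)) (unique⇒distinct (unique p))

Sym-unique : ∀ n → Unique (Sym n)
Sym-unique n = Unique.filter⁺ (T? ∘ distinct) (words-unique n n)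

max∈perm : ∀ n {σ} → IsPerm (suc n) σ → suc n ∈ σ
max∈perm n {σ} p with suc n ∈? σ
... | yes n+1∈σ = n+1∈σ
... | no n+1∉σ = ⊥-elim (ℕ.1+n≰n (subst₂ _≤_ (length≡ p) (length-range1 n) (unique⊆⇒length≤ (unique p) σ⊆range1)))
  where
  σ⊆range1 : ∀ {z} → z ∈ σ → z ∈ range1 n
  σ⊆range1 {z} z∈ with All.lookup (inRange p) z∈
  ... | 1≤z , z≤n+1 = ∈-range1⁺ (1≤z , ℕ.≤-pred (ℕ.≤∧≢⇒< z≤n+1 (λ z≡n+1 → n+1∉σ (subst (_∈ σ) z≡n+1 z∈))))

IsPerm-resp-↭ : ∀ {n σ σ′} → σ ↭ σ′ → IsPerm n σ → IsPerm n σ′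
IsPerm-resp-↭ p σ-perm = record
  { length≡ = trans (sym (↭.↭-length p)) (length≡ σ-perm)
  ; inRange = ↭.All-resp-↭ p (inRange σ-perm)
  ; unique  = Unique-resp-↭ p (unique σ-perm)
  }

max∉ : ∀ {n τ} → IsPerm n τ → suc n ∉ τ
max∉ τ-perm n+1∈τ = ℕ.1+n≰n (proj₂ (All.lookup (inRange τ-perm) n+1∈τ))

IsPerm-max∷ : ∀ {n τ} → IsPerm n τ → IsPerm (suc n) (suc n ∷ τ)
IsPerm-max∷ {n} τ-perm = record
  { length≡ = cong suc (length≡ τ-perm)
  ; inRange = (s≤s z≤n , ℕ.≤-refl) ∷ All.map (Product.map₂ ℕ.m≤n⇒m≤1+n) (inRange τ-perm)
  ; unique  = All.tabulate (λ x∈τ n+1≡x → max∉ τ-perm (subst (_∈ _) (sym n+1≡x) x∈τ)) ∷ unique τ-perm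
  }

IsPerm-max∷⁻ : ∀ {n τ} → IsPerm (suc n) (suc n ∷ τ) → IsPerm n τ
IsPerm-max∷⁻ {n} {τ} σ-perm with inRange σ-perm | unique σ-perm
... | _ ∷ τ-inRange | n+1≢τ ∷ τ-unique = record
  { length≡ = ℕ.suc-injective (length≡ σ-perm)
  ; inRange = All.zipWith (λ { ((1≤x , x≤n+1) , n+1≢x) → 1≤x , ℕ.≤-pred (ℕ.≤∧≢⇒< x≤n+1 (n+1≢x ∘ sym)) })
                          (τ-inRange , n+1≢τ)
  ; unique  = τ-unique
  }

-- Ascents, excedances and the Eulerian recurrence

asc : List ℕ → ℕ
asc []          = 0
asc (x ∷ [])    = 0
asc (x ∷ y ∷ r) = bit (x ≤ᵇ y) +ℕ asc (y ∷ r)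

excFrom : ℕ → List ℕ → ℕ
excFrom i []       = 0
excFrom i (x ∷ xs) = bit (i <ᵇ x) +ℕ excFrom (suc i) xs

eulerianStep : ℕ → (ℕ → ℤ) → ℕ → ℤ
eulerianStep n g k = + suc k * g k + + (n ∸ k) * g (suc k)

asc≤length : ∀ τ → asc τ ≤ length τ
asc≤length []          = z≤n
asc≤length (x ∷ [])    = z≤n
asc≤length (x ∷ y ∷ r) = ℕ.+-mono-≤ (bit≤1 (x ≤ᵇ y)) (asc≤length (y ∷ r))

excFrom≤length : ∀ i τ → excFrom i τ ≤ length τ
excFrom≤length i []       = z≤n
excFrom≤length i (x ∷ xs) = ℕ.+-mono-≤ (bit≤1 (i <ᵇ x)) (excFrom≤length (suc i) xs)

+[1+n∸k]≡1++[n∸k] : ∀ {k n} → k ≤ n → + (suc n ∸ k) ≡ + 1 + + (n ∸ k)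
+[1+n∸k]≡1++[n∸k] {k} {n} k≤n = trans (cong +_ (ℕ.+-∸-assoc 1 k≤n)) (ℤ.pos-+ 1 (n ∸ k))

insertions : ℕ → List ℕ → List (List ℕ)
insertions M []      = [ [ M ] ]
insertions M (x ∷ r) = (M ∷ x ∷ r) ∷ map (x ∷_) (insertions M r)

addToFirstCoefficient : ∀ G₀ G₁ a K → G₀ + (a * G₀ + K * G₁) ≡ (+ 1 + a) * G₀ + K * G₁
addToFirstCoefficient = ℤ-Solver.solve-∀

addToSecondCoefficient : ∀ G₀ G₁ a K → G₁ + (a * G₀ + K * G₁) ≡ a * G₀ + (+ 1 + K) * G₁
addToSecondCoefficient = ℤ-Solver.solve-∀

∑-insertions-∷ : ∀ {M y} r (h : List ℕ → ℤ) →
                 ∑ h (insertions M (y ∷ r)) ≡ h (M ∷ y ∷ r) + ∑ (h ∘ (y ∷_)) (insertions M r)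
∑-insertions-∷ {M} {y} r h = cong (_+_ (h (M ∷ y ∷ r))) (∑-map h (y ∷_) (insertions M r))

insertionStep : ∀ {M} x y r → x < M → y < M →
                (∀ g → ∑ (g ∘ asc) (insertions M (y ∷ r)) ≡ eulerianStep (length (y ∷ r)) g (asc (y ∷ r))) →
                ∀ g → ∑ (g ∘ asc) (insertions M (x ∷ y ∷ r)) ≡ eulerianStep (length (x ∷ y ∷ r)) g (asc (x ∷ y ∷ r))
insertionStep {M} x y r x<M y<M ih g = begin
  ∑ (g ∘ asc) (insertions M (x ∷ y ∷ r))
    ≡⟨ ∑-insertions-∷ (y ∷ r) (g ∘ asc) ⟩
  g (asc (M ∷ x ∷ y ∷ r)) + ∑ (g ∘ asc ∘ (x ∷_)) (insertions M (y ∷ r))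
    ≡⟨ cong (_+_ (g (asc (M ∷ x ∷ y ∷ r)))) (∑-insertions-∷ r (g ∘ asc ∘ (x ∷_))) ⟩
  g (asc (M ∷ x ∷ y ∷ r)) + (g (asc (x ∷ M ∷ y ∷ r)) + rest (bit (x ≤ᵇ y)))
    ≡⟨ cong₂ (λ p q → g p + (g q + rest (bit (x ≤ᵇ y))))
             (cong (λ b → bit b +ℕ asc (x ∷ y ∷ r)) (≤ᵇ-false x<M))
             (cong₂ (λ b b′ → bit b +ℕ (bit b′ +ℕ a)) (≤ᵇ-true (ℕ.<⇒≤ x<M)) (≤ᵇ-false y<M)) ⟩
  g (asc (x ∷ y ∷ r)) + (g (suc a) + rest (bit (x ≤ᵇ y)))
    ≡⟨ byAscentAt (x ≤ᵇ y) ⟩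
  eulerianStep (length (x ∷ y ∷ r)) g (asc (x ∷ y ∷ r)) ∎
  where
  open ≡-Reasoning
  a = asc (y ∷ r)
  L = length (y ∷ r)
  rest : ℕ → ℤ
  rest c = ∑ (λ w → g (c +ℕ asc (y ∷ w))) (insertions M r)
  shifted : ∀ c → g (c +ℕ a) + rest c ≡ eulerianStep L (g ∘ (c +ℕ_)) a
  shifted c = trans (sym (trans (∑-insertions-∷ r (g ∘ (c +ℕ_) ∘ asc))
                                (cong (λ b → g (c +ℕ (bit b +ℕ a)) + rest c) (≤ᵇ-false y<M))))
                    (ih (g ∘ (c +ℕ_)))
  byAscentAt : ∀ β → g (bit β +ℕ a) + (g (suc a) + rest (bit β)) ≡ eulerianStep (suc L) g (bit β +ℕ a)
  byAscentAt true  = trans (cong (_+_ (g (suc a))) (shifted 1))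
                           (addToFirstCoefficient (g (suc a)) (g (suc (suc a))) (+ suc a) (+ (L ∸ a)))
  byAscentAt false = begin
    g a + (g (suc a) + rest 0)                           ≡⟨ x+[y+z]≡y+[x+z] (g a) (g (suc a)) (rest 0) ⟩
    g (suc a) + (g a + rest 0)                           ≡⟨ cong (_+_ (g (suc a))) (shifted 0) ⟩
    g (suc a) + (+ suc a * g a + + (L ∸ a) * g (suc a))  ≡⟨ addToSecondCoefficient (g a) (g (suc a)) (+ suc a) (+ (L ∸ a)) ⟩
    + suc a * g a + (+ 1 + + (L ∸ a)) * g (suc a)        ≡⟨ cong (λ K → + suc a * g a + K * g (suc a)) (+[1+n∸k]≡1++[n∸k] (asc≤length (y ∷ r))) ⟨
    eulerianStep (suc L) g a                             ∎

∑-insertions-asc : ∀ {M} τ → All (_< M) τ → (g : ℕ → ℤ) →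
                   ∑ (g ∘ asc) (insertions M τ) ≡ eulerianStep (length τ) g (asc τ)
∑-insertions-asc [] _ g = lemma (g 0) (g 1)
  where
  lemma : ∀ G₀ G₁ → G₀ + + 0 ≡ + 1 * G₀ + + 0 * G₁
  lemma = ℤ-Solver.solve-∀
∑-insertions-asc (x ∷ []) (x<M ∷ []) g rewrite ≤ᵇ-false x<M | ≤ᵇ-true (ℕ.<⇒≤ x<M) = lemma (g 0) (g 1)
  where
  lemma : ∀ G₀ G₁ → G₀ + (G₁ + + 0) ≡ + 1 * G₀ + + 1 * G₁
  lemma = ℤ-Solver.solve-∀
∑-insertions-asc (x ∷ y ∷ r) (x<M ∷ y<M ∷ r<M) =
  insertionStep x y r x<M y<M (∑-insertions-asc (y ∷ r) (y<M ∷ r<M))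

delete : ℕ → List ℕ → List ℕ
delete M = filter (λ x → ¬? (M ℕ.≟ x))

delete-mid : ∀ {M} ys zs → M ∉ ys → M ∉ zs → delete M (ys ++ M ∷ zs) ≡ ys ++ zs
delete-mid {M} ys zs M∉ys M∉zs = begin
  delete M (ys ++ M ∷ zs)          ≡⟨ filter-++ ≢M? ys (M ∷ zs) ⟩
  delete M ys ++ delete M (M ∷ zs) ≡⟨ cong₂ _++_ (filter-all ≢M? (All.¬Any⇒All¬ ys M∉ys))
                                                (filter-reject ≢M? {M} {zs} (λ M≢M → M≢M refl)) ⟩
  ys ++ delete M zs                ≡⟨ cong (ys ++_) (filter-all ≢M? (All.¬Any⇒All¬ zs M∉zs)) ⟩
  ys ++ zs                         ∎
  where
  open ≡-Reasoning
  ≢M? = λ x → ¬? (M ℕ.≟ x)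

∈-insertions⁻ : ∀ {M} τ {σ} → σ ∈ insertions M τ → ∃[ ys ] ∃[ zs ] τ ≡ ys ++ zs × σ ≡ ys ++ M ∷ zs
∈-insertions⁻ [] (here refl) = [] , [] , refl , refl
∈-insertions⁻ (x ∷ r) (here refl) = [] , x ∷ r , refl , refl
∈-insertions⁻ (x ∷ r) (there σ∈) with ∈.∈-map⁻ (x ∷_) σ∈
... | w , w∈ , refl with ∈-insertions⁻ r w∈
... | ys , zs , refl , refl = x ∷ ys , zs , refl , refl

∈-insertions⁺ : ∀ {M} ys zs → ys ++ M ∷ zs ∈ insertions M (ys ++ zs)
∈-insertions⁺ [] [] = here refl
∈-insertions⁺ [] (z ∷ zs) = here refl
∈-insertions⁺ (y ∷ ys) zs = there (∈.∈-map⁺ (y ∷_) (∈-insertions⁺ ys zs))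

insertions-unique : ∀ {M} τ → M ∉ τ → Unique (insertions M τ)
insertions-unique [] _ = [] ∷ []
insertions-unique {M} (x ∷ r) M∉ =
  All.tabulate head≢ ∷ Unique.map⁺ ∷-injectiveʳ (insertions-unique r (M∉ ∘ there))
  where
  head≢ : ∀ {w} → w ∈ map (x ∷_) (insertions M r) → M ∷ x ∷ r ≢ w
  head≢ w∈ eq with ∈.∈-map⁻ (x ∷_) w∈
  ... | _ , _ , refl = M∉ (here (∷-injectiveˡ eq))

∑-Sym-suc-asc : ∀ n g → ∑ (g ∘ asc) (Sym (suc n)) ≡ ∑ (eulerianStep n g ∘ asc) (Sym n)
∑-Sym-suc-asc n g =
  trans (∑-fibres (g ∘ asc) (delete M) (insertions M) (Sym-unique n) (Sym-unique M)
          (λ τ∈ → insertions-unique _ (max∉ (∈-Sym⁻ n τ∈))) into onto)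
        (∑-cong (Sym n) sum-fibre)
  where
  M = suc n
  into : ∀ {τ σ} → τ ∈ Sym n → σ ∈ insertions M τ → σ ∈ Sym M × delete M σ ≡ τ
  into {τ} τ∈ σ∈ with ∈-insertions⁻ τ σ∈
  ... | ys , zs , refl , refl =
    ∈-Sym⁺ M (IsPerm-resp-↭ (↭-sym (↭.shift M ys zs)) (IsPerm-max∷ τ-perm)) ,
    delete-mid ys zs (max∉ τ-perm ∘ ∈.∈-++⁺ˡ) (max∉ τ-perm ∘ ∈.∈-++⁺ʳ ys)
    where τ-perm = ∈-Sym⁻ n τ∈
  onto : ∀ {σ} → σ ∈ Sym M → delete M σ ∈ Sym n × σ ∈ insertions M (delete M σ)
  onto σ∈ with ∈.∈-∃++ (max∈perm n (∈-Sym⁻ M σ∈))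
  ... | ys , zs , refl =
    subst (λ τ → τ ∈ Sym n × ys ++ M ∷ zs ∈ insertions M τ)
      (sym (delete-mid ys zs (M∉ ∘ ∈.∈-++⁺ˡ) (M∉ ∘ ∈.∈-++⁺ʳ ys)))
      (∈-Sym⁺ n (IsPerm-max∷⁻ (IsPerm-resp-↭ (↭.shift M ys zs) (∈-Sym⁻ M σ∈))) , ∈-insertions⁺ ys zs)
    where M∉ = unique-mid⇒∉ ys zs (unique (∈-Sym⁻ M σ∈))
  sum-fibre : ∀ {τ} → τ ∈ Sym n → ∑ (g ∘ asc) (insertions M τ) ≡ eulerianStep n g (asc τ)
  sum-fibre {τ} τ∈ = trans (∑-insertions-asc τ (All.map (s≤s ∘ proj₂) (inRange τ-perm)) g)
                           (cong (λ L → eulerianStep L g (asc τ)) (length≡ τ-perm))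
    where τ-perm = ∈-Sym⁻ n τ∈

replacementStep : ℕ → (ℕ → ℤ) → ℕ → ℤ
replacementStep n g k = + k * g k + + (n ∸ k) * g (suc k)

replacements : ℕ → List ℕ → List (List ℕ × ℕ)
replacements M []      = []
replacements M (x ∷ r) = (M ∷ r , x) ∷ map (Product.map₁ (x ∷_)) (replacements M r)

∑-replacements-exc : ∀ {M} i τ → i +ℕ length τ ≤ M → (g : ℕ → ℤ) →
                     ∑ (g ∘ excFrom i ∘ proj₁) (replacements M τ) ≡ replacementStep (length τ) g (excFrom i τ)
∑-replacements-exc i [] _ g = lemma (g 0) (g 1)
  where
  lemma : ∀ G₀ G₁ → + 0 ≡ + 0 * G₀ + + 0 * G₁
  lemma = ℤ-Solver.solve-∀
∑-replacements-exc {M} i (x ∷ r) i+L≤M g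
  rewrite <ᵇ-true (ℕ.<-≤-trans (ℕ.m<m+n i (s≤s z≤n)) i+L≤M)
        | ∑-map (g ∘ excFrom i ∘ proj₁) (Product.map₁ (x ∷_)) (replacements M r) =
  byExcedanceAt (i <ᵇ x)
  where
  E = excFrom (suc i) r
  L = length r
  ih : ∀ g → ∑ (g ∘ excFrom (suc i) ∘ proj₁) (replacements M r) ≡ replacementStep L g E
  ih = ∑-replacements-exc (suc i) r (subst (_≤ M) (ℕ.+-suc i L) i+L≤M)
  byExcedanceAt : ∀ β → g (suc E) + ∑ (λ p → g (bit β +ℕ excFrom (suc i) (proj₁ p))) (replacements M r) ≡
                        replacementStep (suc L) g (bit β +ℕ E)
  byExcedanceAt true = trans (cong (_+_ (g (suc E))) (ih (g ∘ suc)))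
                             (addToFirstCoefficient (g (suc E)) (g (suc (suc E))) (+ E) (+ (L ∸ E)))
  byExcedanceAt false = trans (cong (_+_ (g (suc E))) (ih g))
    (trans (addToSecondCoefficient (g E) (g (suc E)) (+ E) (+ (L ∸ E)))
           (cong (λ K → + E * g E + K * g (suc E)) (sym (+[1+n∸k]≡1++[n∸k] (excFrom≤length (suc i) r)))))

-- In one-line notation, inserting M into the cycle of τ right after j replaces τ(j) by M and
-- appends τ(j); inserting M as a fixed point appends M.
cycleInsertions : ℕ → List ℕ → List (List ℕ)
cycleInsertions M τ = (τ ∷ʳ M) ∷ map (Product.uncurry _∷ʳ_) (replacements M τ)

excFrom-∷ʳ : ∀ i w v → excFrom i (w ∷ʳ v) ≡ excFrom i w +ℕ bit (length w +ℕ i <ᵇ v)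
excFrom-∷ʳ i [] v = ℕ.+-identityʳ _
excFrom-∷ʳ i (x ∷ w) v rewrite excFrom-∷ʳ (suc i) w v | ℕ.+-suc (length w) i =
  sym (ℕ.+-assoc (bit (i <ᵇ x)) _ _)

excFrom-∷ʳ-≤ : ∀ i w v → v ≤ length w +ℕ i → excFrom i (w ∷ʳ v) ≡ excFrom i w
excFrom-∷ʳ-≤ i w v v≤ rewrite excFrom-∷ʳ i w v | <ᵇ-false v≤ = ℕ.+-identityʳ _

∈-replacements⁻ : ∀ {M} τ {p} → p ∈ replacements M τ →
                  ∃[ ys ] ∃[ zs ] ∃[ v ] τ ≡ ys ++ v ∷ zs × p ≡ (ys ++ M ∷ zs , v)
∈-replacements⁻ (x ∷ r) (here refl) = [] , r , x , refl , refl
∈-replacements⁻ (x ∷ r) (there p∈) with ∈.∈-map⁻ (Product.map₁ (x ∷_)) p∈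
... | _ , p′∈ , refl with ∈-replacements⁻ r p′∈
... | ys , zs , v , refl , refl = x ∷ ys , zs , v , refl , refl

∈-replacements⁺ : ∀ {M} ys zs v → (ys ++ M ∷ zs , v) ∈ replacements M (ys ++ v ∷ zs)
∈-replacements⁺ [] zs v = here refl
∈-replacements⁺ (y ∷ ys) zs v = there (∈.∈-map⁺ (Product.map₁ (y ∷_)) (∈-replacements⁺ ys zs v))

replacements-unique : ∀ {M} τ → M ∉ τ → Unique (replacements M τ)
replacements-unique [] _ = []
replacements-unique {M} (x ∷ r) M∉ =
  All.tabulate head≢ ∷ Unique.map⁺ map₁-injective (replacements-unique r (M∉ ∘ there))
  where
  map₁-injective : ∀ {p q : List ℕ × ℕ} → Product.map₁ (x ∷_) p ≡ Product.map₁ (x ∷_) q → p ≡ q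
  map₁-injective eq = cong₂ _,_ (∷-injectiveʳ (cong proj₁ eq)) (cong proj₂ eq)
  head≢ : ∀ {p} → p ∈ map (Product.map₁ (x ∷_)) (replacements M r) → (M ∷ r , x) ≢ p
  head≢ p∈ eq with ∈.∈-map⁻ (Product.map₁ (x ∷_)) p∈
  ... | _ , _ , refl = M∉ (here (∷-injectiveˡ (cong proj₁ eq)))

cycleInsertions-unique : ∀ {M} τ → M ∉ τ → Unique (cycleInsertions M τ)
cycleInsertions-unique {M} τ M∉ =
  All.tabulate head≢ ∷ Unique.map⁺ ∷ʳ-injective′ (replacements-unique τ M∉)
  where
  ∷ʳ-injective′ : ∀ {p q : List ℕ × ℕ} → Product.uncurry _∷ʳ_ p ≡ Product.uncurry _∷ʳ_ q → p ≡ q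
  ∷ʳ-injective′ {w , v} {w′ , v′} eq = Product.uncurry (cong₂ _,_) (∷ʳ-injective w w′ eq)
  head≢ : ∀ {σ} → σ ∈ map (Product.uncurry _∷ʳ_) (replacements M τ) → τ ∷ʳ M ≢ σ
  head≢ σ∈ eq with ∈.∈-map⁻ (Product.uncurry _∷ʳ_) σ∈
  ... | (w , v) , p∈ , refl with ∈-replacements⁻ τ p∈
  ...   | ys , zs , _ , refl , refl =
    M∉ (subst (_∈ ys ++ v ∷ zs) (sym (∷ʳ-injectiveʳ (ys ++ v ∷ zs) w eq)) (∈.∈-++⁺ʳ ys (here refl)))

∑-cycleInsertions-exc : ∀ {n τ} → IsPerm n τ → (g : ℕ → ℤ) →
                        ∑ (g ∘ excFrom 1) (cycleInsertions (suc n) τ) ≡ eulerianStep n g (excFrom 1 τ)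
∑-cycleInsertions-exc {n} {τ} τ-perm g = begin
  g (excFrom 1 (τ ∷ʳ suc n)) + ∑ (g ∘ excFrom 1) (map (Product.uncurry _∷ʳ_) (replacements (suc n) τ))
    ≡⟨ cong₂ _+_ (cong g (excFrom-∷ʳ-≤ 1 τ (suc n) (ℕ.≤-reflexive (trans (cong suc n≡L) (ℕ.+-comm 1 L)))))
                 (trans (∑-map (g ∘ excFrom 1) (Product.uncurry _∷ʳ_) (replacements (suc n) τ))
                        (∑-cong (replacements (suc n) τ) appended-no-exc)) ⟩
  g e + ∑ (g ∘ excFrom 1 ∘ proj₁) (replacements (suc n) τ)
    ≡⟨ cong (_+_ (g e)) (∑-replacements-exc 1 τ (s≤s (ℕ.≤-reflexive (length≡ τ-perm))) g) ⟩
  g e + replacementStep L g e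
    ≡⟨ cong (λ L → g e + replacementStep L g e) (length≡ τ-perm) ⟩
  g e + replacementStep n g e
    ≡⟨ addToFirstCoefficient (g e) (g (suc e)) (+ e) (+ (n ∸ e)) ⟩
  eulerianStep n g e ∎
  where
  open ≡-Reasoning
  e = excFrom 1 τ
  L = length τ
  n≡L = sym (length≡ τ-perm)
  appended-no-exc : ∀ {p} → p ∈ replacements (suc n) τ → g (excFrom 1 (proj₁ p ∷ʳ proj₂ p)) ≡ g (excFrom 1 (proj₁ p))
  appended-no-exc p∈ with ∈-replacements⁻ τ p∈
  ... | ys , zs , v , refl , refl = cong g (excFrom-∷ʳ-≤ 1 (ys ++ suc n ∷ zs) v v≤)
    where
    v≤ : v ≤ length (ys ++ suc n ∷ zs) +ℕ 1
    v≤ = ℕ.≤-trans (proj₂ (All.lookup (inRange τ-perm) (∈.∈-++⁺ʳ ys (here refl))))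
           (ℕ.≤-trans (ℕ.≤-reflexive (trans (sym (length≡ τ-perm))
                                            (trans (length-++-sucʳ ys v zs) (sym (length-++-sucʳ ys (suc n) zs)))))
                      (ℕ.m≤m+n _ 1))

replace : ℕ → ℕ → ℕ → ℕ
replace M v x = if x ≡ᵇ M then v else x

init′ : List ℕ → List ℕ
init′ []          = []
init′ (x ∷ [])    = []
init′ (x ∷ y ∷ r) = x ∷ init′ (y ∷ r)

last′ : List ℕ → ℕ
last′ []          = 0
last′ (x ∷ [])    = x
last′ (x ∷ y ∷ r) = last′ (y ∷ r)

init′-∷ʳ : ∀ w v → init′ (w ∷ʳ v) ≡ w
init′-∷ʳ [] v = refl
init′-∷ʳ (x ∷ []) v = refl
init′-∷ʳ (x ∷ y ∷ w) v = cong (x ∷_) (init′-∷ʳ (y ∷ w) v)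

last′-∷ʳ : ∀ w v → last′ (w ∷ʳ v) ≡ v
last′-∷ʳ [] v = refl
last′-∷ʳ (x ∷ []) v = refl
last′-∷ʳ (x ∷ y ∷ w) v = last′-∷ʳ (y ∷ w) v

uncycle : ℕ → List ℕ → List ℕ
uncycle M σ = map (replace M (last′ σ)) (init′ σ)

uncycle-∷ʳ : ∀ M w v → uncycle M (w ∷ʳ v) ≡ map (replace M v) w
uncycle-∷ʳ M w v rewrite init′-∷ʳ w v | last′-∷ʳ w v = refl

map-replace-∉ : ∀ {M} v w → M ∉ w → map (replace M v) w ≡ w
map-replace-∉ v [] _ = refl
map-replace-∉ {M} v (x ∷ w) M∉ with x ≡ᵇ M in eq
... | true = ⊥-elim (M∉ (here (sym (ℕ.≡ᵇ⇒≡ x M (subst T (sym eq) _)))))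
... | false = cong (x ∷_) (map-replace-∉ v w (M∉ ∘ there))

map-replace-self : ∀ M w → map (replace M M) w ≡ w
map-replace-self M [] = refl
map-replace-self M (x ∷ w) with x ≡ᵇ M in eq
... | true = cong₂ _∷_ (sym (ℕ.≡ᵇ⇒≡ x M (subst T (sym eq) _))) (map-replace-self M w)
... | false = cong (x ∷_) (map-replace-self M w)

uncycle-mid : ∀ {M} ys zs v → M ∉ ys → M ∉ zs → uncycle M ((ys ++ M ∷ zs) ∷ʳ v) ≡ ys ++ v ∷ zs
uncycle-mid {M} ys zs v M∉ys M∉zs = begin
  uncycle M ((ys ++ M ∷ zs) ∷ʳ v)                        ≡⟨ uncycle-∷ʳ M (ys ++ M ∷ zs) v ⟩
  map (replace M v) (ys ++ M ∷ zs)                       ≡⟨ map-++ (replace M v) ys (M ∷ zs) ⟩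
  map (replace M v) ys ++ replace M v M ∷ map (replace M v) zs
    ≡⟨ cong₂ (λ as bs → as ++ replace M v M ∷ bs) (map-replace-∉ v ys M∉ys) (map-replace-∉ v zs M∉zs) ⟩
  ys ++ replace M v M ∷ zs                               ≡⟨ cong (λ b → ys ++ (if b then v else M) ∷ zs) (≡ᵇ-refl M) ⟩
  ys ++ v ∷ zs                                           ∎
  where
  open ≡-Reasoning
  ≡ᵇ-refl : ∀ x → (x ≡ᵇ x) ≡ true
  ≡ᵇ-refl x = to T-≡ (ℕ.≡⇒≡ᵇ x x refl)

∑-Sym-suc-exc : ∀ n g → ∑ (g ∘ excFrom 1) (Sym (suc n)) ≡ ∑ (eulerianStep n g ∘ excFrom 1) (Sym n)
∑-Sym-suc-exc n g =
  trans (∑-fibres (g ∘ excFrom 1) (uncycle M) (cycleInsertions M) (Sym-unique n) (Sym-unique M)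
          (λ τ∈ → cycleInsertions-unique _ (max∉ (∈-Sym⁻ n τ∈))) into onto)
        (∑-cong (Sym n) (λ τ∈ → ∑-cycleInsertions-exc (∈-Sym⁻ n τ∈) g))
  where
  M = suc n
  into : ∀ {τ σ} → τ ∈ Sym n → σ ∈ cycleInsertions M τ → σ ∈ Sym M × uncycle M σ ≡ τ
  into {τ} τ∈ (here refl) =
    ∈-Sym⁺ M (IsPerm-resp-↭ (↭.∷↭∷ʳ M τ) (IsPerm-max∷ (∈-Sym⁻ n τ∈))) ,
    trans (uncycle-∷ʳ M τ M) (map-replace-self M τ)
  into {τ} τ∈ (there σ∈) with ∈.∈-map⁻ (Product.uncurry _∷ʳ_) σ∈
  ... | _ , p∈ , refl with ∈-replacements⁻ τ p∈
  ... | ys , zs , v , refl , refl =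
    ∈-Sym⁺ M (IsPerm-resp-↭ (↭-sym (shift-∷ʳ M ys zs v)) (IsPerm-max∷ τ-perm)) ,
    uncycle-mid ys zs v (max∉ τ-perm ∘ ∈.∈-++⁺ˡ) (max∉ τ-perm ∘ ∈.∈-++⁺ʳ ys ∘ there)
    where τ-perm = ∈-Sym⁻ n τ∈
  onto : ∀ {σ} → σ ∈ Sym M → uncycle M σ ∈ Sym n × σ ∈ cycleInsertions M (uncycle M σ)
  onto {σ} σ∈ with initLast σ
  ... | [] = ⊥-elim (ℕ.1+n≢0 (sym (length≡ (∈-Sym⁻ M σ∈))))
  ... | w ∷ʳ′ v with v ℕ.≟ M
  ...   | yes refl rewrite uncycle-∷ʳ M w M | map-replace-self M w =
    ∈-Sym⁺ n (IsPerm-max∷⁻ (IsPerm-resp-↭ (↭-sym (↭.∷↭∷ʳ M w)) (∈-Sym⁻ M σ∈))) , here refl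
  ...   | no v≢M with ∈.∈-++⁻ w (max∈perm n (∈-Sym⁻ M σ∈))
  ...     | inj₂ (here M≡v) = ⊥-elim (v≢M (sym M≡v))
  ...     | inj₁ M∈w with ∈.∈-∃++ M∈w
  ...       | ys , zs , refl =
    subst (λ τ → τ ∈ Sym n × (ys ++ M ∷ zs) ∷ʳ v ∈ cycleInsertions M τ)
      (sym (uncycle-mid ys zs v (M∉ ∘ ∈.∈-++⁺ˡ) (M∉ ∘ ∈.∈-++⁺ʳ ys ∘ there)))
      (∈-Sym⁺ n (IsPerm-max∷⁻ σ′-perm) , there (∈.∈-map⁺ (Product.uncurry _∷ʳ_) (∈-replacements⁺ ys zs v)))
    where
    σ′-perm = IsPerm-resp-↭ (shift-∷ʳ M ys zs v) (∈-Sym⁻ M σ∈)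
    M∉ = Unique.Unique[x∷xs]⇒x∉xs (unique σ′-perm)

asc-exc-equidistributed : ∀ n g → ∑ (g ∘ excFrom 1) (Sym n) ≡ ∑ (g ∘ asc) (Sym n)
asc-exc-equidistributed zero g = refl
asc-exc-equidistributed (suc n) g = begin
  ∑ (g ∘ excFrom 1) (Sym (suc n))              ≡⟨ ∑-Sym-suc-exc n g ⟩
  ∑ (eulerianStep n g ∘ excFrom 1) (Sym n)     ≡⟨ asc-exc-equidistributed n (eulerianStep n g) ⟩
  ∑ (eulerianStep n g ∘ asc) (Sym n)           ≡⟨ ∑-Sym-suc-asc n g ⟨
  ∑ (g ∘ asc) (Sym (suc n))                    ∎
  where open ≡-Reasoning

excFrom-count : ∀ i σ → count (λ k → k +ℕ i <ᵇ at σ k) (range1 (length σ)) ≡ excFrom (suc i) σ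
excFrom-count i [] = refl
excFrom-count i (x ∷ xs) = trans (count-range1-suc (λ k → k +ℕ i <ᵇ at (x ∷ xs) k) (length xs))
  (cong (bit (suc i <ᵇ x) +ℕ_) (trans (count-cong {q = λ k → k +ℕ suc i <ᵇ at xs k} (range1 (length xs)) shift)
                                      (excFrom-count (suc i) xs)))
  where
  shift : ∀ {k} → k ∈ range1 (length xs) → (suc k +ℕ i <ᵇ at (x ∷ xs) (suc k)) ≡ (k +ℕ suc i <ᵇ at xs k)
  shift {k} k∈ with ∈-range1⁻ k∈
  shift {suc j} k∈ | _ rewrite ℕ.+-suc (suc j) i = refl

exc≡excFrom1 : ∀ σ → exc (length σ) σ ≡ excFrom 1 σ
exc≡excFrom1 σ = trans (count-cong (range1 (length σ)) (λ {k} _ → cong (_<ᵇ at σ k) (sym (ℕ.+-identityʳ k))))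
                       (excFrom-count 0 σ)

∑-Sym-exc≡∑-Sym-asc : ∀ n g → ∑ (g ∘ exc n) (Sym n) ≡ ∑ (g ∘ asc) (Sym n)
∑-Sym-exc≡∑-Sym-asc n g = trans (∑-cong (Sym n) exc≡) (asc-exc-equidistributed n g)
  where
  exc≡ : ∀ {σ} → σ ∈ Sym n → g (exc n σ) ≡ g (excFrom 1 σ)
  exc≡ {σ} σ∈ = cong g (trans (cong (λ L → exc L σ) (sym (length≡ (∈-Sym⁻ n σ∈)))) (exc≡excFrom1 σ))

A≡∑asc : ∀ n t → A n t ≡ ∑ (λ σ → t ^ asc σ) (Sym n)
A≡∑asc n t = ∑-Sym-exc≡∑-Sym-asc n (t ^_)

-- The expansion of t A_{n-1}(t)

asc-∷ʳ : ∀ x τ v → asc ((x ∷ τ) ∷ʳ v) ≡ asc (x ∷ τ) +ℕ bit (last′ (x ∷ τ) ≤ᵇ v)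
asc-∷ʳ x [] v = ℕ.+-identityʳ _
asc-∷ʳ x (y ∷ τ) v = trans (cong (bit (x ≤ᵇ y) +ℕ_) (asc-∷ʳ y τ v)) (sym (ℕ.+-assoc (bit (x ≤ᵇ y)) _ _))

last′∈ : ∀ x xs → last′ (x ∷ xs) ∈ x ∷ xs
last′∈ x [] = here refl
last′∈ x (y ∷ xs) = there (last′∈ y xs)

ascents-at : ∀ u → count (λ j → at u j ≤ᵇ at u (suc j)) (range1 (length u ∸ 1)) ≡ asc u
ascents-at [] = refl
ascents-at (x ∷ []) = refl
ascents-at (x ∷ y ∷ r) = trans (count-range1-suc (λ j → at (x ∷ y ∷ r) j ≤ᵇ at (x ∷ y ∷ r) (suc j)) (length r))
  (cong (bit (x ≤ᵇ y) +ℕ_) (trans (count-cong {q = λ j → at (y ∷ r) j ≤ᵇ at (y ∷ r) (suc j)} (range1 (length r)) shift)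
                                  (ascents-at (y ∷ r))))
  where
  shift : ∀ {j} → j ∈ range1 (length r) →
          (at (x ∷ y ∷ r) (suc j) ≤ᵇ at (x ∷ y ∷ r) (suc (suc j))) ≡ (at (y ∷ r) j ≤ᵇ at (y ∷ r) (suc j))
  shift {j} j∈ with ∈-range1⁻ j∈
  shift {suc i} _ | _ = refl

at-∷ʳ-< : ∀ w v k → 1 ≤ k → k ≤ length w → at (w ∷ʳ v) k ≡ at w k
at-∷ʳ-< (x ∷ w) v (suc zero) _ _ = refl
at-∷ʳ-< (x ∷ w) v (suc (suc i)) _ (s≤s i<) = at-∷ʳ-< w v (suc i) (s≤s z≤n) i<

at-∷ʳ-last : ∀ w v → at (w ∷ʳ v) (suc (length w)) ≡ v
at-∷ʳ-last [] v = refl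
at-∷ʳ-last (x ∷ w) v = at-∷ʳ-last w v

ext≡at-∷ʳ : ∀ σ j → 1 ≤ j → j ≤ suc (length σ) → ext (length σ) σ j ≡ at (σ ∷ʳ length σ) j
ext≡at-∷ʳ σ j 1≤j j≤ with j ≡ᵇ suc (length σ) in eq
... | true rewrite ℕ.≡ᵇ⇒≡ j (suc (length σ)) (subst T (sym eq) _) = sym (at-∷ʳ-last σ (length σ))
... | false = sym (at-∷ʳ-< σ (length σ) j 1≤j (ℕ.≤-pred (ℕ.≤∧≢⇒< j≤ j≢)))
  where
  j≢ : j ≢ suc (length σ)
  j≢ j≡ = subst T eq (ℕ.≡⇒≡ᵇ j _ j≡)

nonDescents-count : ∀ σ {L} → length σ ≡ L → count (not ∘ desc L σ) (range1 L) ≡ asc (σ ∷ʳ L)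
nonDescents-count σ refl = begin
  count (not ∘ desc L σ) (range1 L)                   ≡⟨ count-cong (range1 L) via-at ⟩
  count (λ j → at u j ≤ᵇ at u (suc j)) (range1 L)     ≡⟨ cong (λ k → count (λ j → at u j ≤ᵇ at u (suc j)) (range1 k)) L≡ ⟩
  count (λ j → at u j ≤ᵇ at u (suc j)) (range1 (length u ∸ 1)) ≡⟨ ascents-at u ⟩
  asc u                                               ∎
  where
  open ≡-Reasoning
  L = length σ
  u = σ ∷ʳ L
  L≡ : L ≡ length u ∸ 1
  L≡ = sym (trans (cong (_∸ 1) (length-++ σ)) (ℕ.m+n∸n≡m L 1))
  via-at : ∀ {j} → j ∈ range1 L → not (desc L σ j) ≡ (at u j ≤ᵇ at u (suc j))
  via-at {j} j∈ with ∈-range1⁻ j∈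
  ... | 1≤j , j≤L = trans (cong₂ (λ a b → not (a <ᵇ b)) (ext≡at-∷ʳ σ (suc j) (s≤s z≤n) (s≤s j≤L))
                                                      (ext≡at-∷ʳ σ j 1≤j (ℕ.m≤n⇒m≤1+n j≤L)))
                          (not-<ᵇ (at u j) (at u (suc j)))

asc-framedByMax : ∀ {N} y τ → All (_< N) (y ∷ τ) → asc ((N ∷ y ∷ τ) ∷ʳ N) ≡ suc (asc (y ∷ τ))
asc-framedByMax {N} y τ (y<N ∷ τ<N) rewrite ≤ᵇ-false y<N = trans (asc-∷ʳ y τ N)
  (trans (cong (λ b → asc (y ∷ τ) +ℕ bit b) (≤ᵇ-true (ℕ.<⇒≤ (All.lookup (y<N ∷ τ<N) (last′∈ y τ)))))
         (ℕ.+-comm (asc (y ∷ τ)) 1))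

letter-value : ∀ t N σ j → evalLetter t t (+ 1) (+ 1) (letter N σ j) ≡ (if desc N σ j then + 1 else t)
letter-value t N σ j with desc N σ j
... | true with (suc j ≤ᵇ N) ∧ desc N σ (suc j)
...   | true  = refl
...   | false = refl
letter-value t N σ j | false with (2 ≤ᵇ j) ∧ not (desc N σ (j ∸ 1))
...   | true  = refl
...   | false = refl

prod-if : ∀ t (b : ℕ → Bool) xs → prodℤ (map (λ j → if b j then + 1 else t) xs) ≡ t ^ count (not ∘ b) xs
prod-if t b [] = refl
prod-if t b (x ∷ xs) with b x
... | true  = trans (ℤ.*-identityˡ _) (prod-if t b xs)
... | false = cong (_*_ t) (prod-if t b xs)

α-V≡t^nonDescents : ∀ t N σ → α t t (+ 1) (+ 1) (V N σ) ≡ t ^ count (not ∘ desc N σ) (range1 N)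
α-V≡t^nonDescents t N σ = trans (cong prodℤ (trans (sym (map-∘ (range1 N))) (map-cong (letter-value t N σ) (range1 N))))
                       (prod-if t (desc N σ) (range1 N))

α-V-max∷ : ∀ t {N τ} → IsPerm N τ → 1 ≤ N → α t t (+ 1) (+ 1) (V (suc N) (suc N ∷ τ)) ≡ t ^ suc (asc τ)
α-V-max∷ t {τ = []} τ-perm 1≤N = ⊥-elim (ℕ.<⇒≢ 1≤N (length≡ τ-perm))
α-V-max∷ t {N} {y ∷ τ} τ-perm _ = begin
  α t t (+ 1) (+ 1) (V (suc N) (suc N ∷ y ∷ τ))                  ≡⟨ α-V≡t^nonDescents t (suc N) (suc N ∷ y ∷ τ) ⟩
  t ^ count (not ∘ desc (suc N) (suc N ∷ y ∷ τ)) (range1 (suc N)) ≡⟨ cong (t ^_) (nonDescents-count (suc N ∷ y ∷ τ) (length≡ (IsPerm-max∷ τ-perm))) ⟩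
  t ^ asc ((suc N ∷ y ∷ τ) ∷ʳ suc N)                              ≡⟨ cong (t ^_) (asc-framedByMax y τ (All.map (s≤s ∘ proj₂) (inRange τ-perm))) ⟩
  t ^ suc (asc (y ∷ τ))                                           ∎
  where open ≡-Reasoning

∈-Sym′⁻ : ∀ q {σ} → σ ∈ Sym' (suc q) → ∃[ τ ] σ ≡ suc q ∷ τ × τ ∈ Sym q
∈-Sym′⁻ q {σ} σ∈ with ∈.∈-filter⁻ (λ σ → T? (at σ 1 ≡ᵇ suc q)) {xs = Sym (suc q)} σ∈
∈-Sym′⁻ q {[]} σ∈ | σ∈Sym , _ = ⊥-elim (ℕ.1+n≢0 (sym (length≡ (∈-Sym⁻ (suc q) σ∈Sym))))
∈-Sym′⁻ q {x ∷ τ} σ∈ | σ∈Sym , x≡ᵇ with ℕ.≡ᵇ⇒≡ x (suc q) x≡ᵇ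
... | refl = τ , refl , ∈-Sym⁺ q (IsPerm-max∷⁻ (∈-Sym⁻ (suc q) σ∈Sym))

∑-Sym′ : ∀ q (F : List ℕ → ℤ) → ∑ F (Sym' (suc q)) ≡ ∑ (F ∘ (suc q ∷_)) (Sym q)
∑-Sym′ q F = ∑-bijection F (suc q ∷_) (drop 1) (Sym-unique q)
  (Unique.filter⁺ (λ σ → T? (at σ 1 ≡ᵇ suc q)) (Sym-unique (suc q)))
  (λ τ∈ → ∈.∈-filter⁺ (λ σ → T? (at σ 1 ≡ᵇ suc q)) (∈-Sym⁺ (suc q) (IsPerm-max∷ (∈-Sym⁻ q τ∈)))
                      (ℕ.≡⇒≡ᵇ (suc q) (suc q) refl))
  (λ σ∈ → case ∈-Sym′⁻ q σ∈ of λ { (τ , refl , τ∈) → τ∈ })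
  (λ _ → refl)
  (λ σ∈ → case ∈-Sym′⁻ q σ∈ of λ { (τ , refl , τ∈) → refl })

eulerian-expansion : ∀ (n : ℕ) → 2 ≤ n → (c : ℕ → ℤ) → IsExpansion n c →
                     ∀ (t : ℤ) → t * A (n ∸ 1) t ≡ sumK n (λ k → c k * t ^ k * (+ 1 + t) ^ (n ∸ 2 *ℕ k))
eulerian-expansion (suc zero) (s≤s ())
eulerian-expansion (suc (suc q)) _ c expansion t = begin
  t * A N t                                           ≡⟨ cong (t *_) (A≡∑asc N t) ⟩
  t * ∑ (λ τ → t ^ asc τ) (Sym N)                     ≡⟨ *-distribˡ-∑ t _ (Sym N) ⟩
  ∑ (λ τ → t ^ suc (asc τ)) (Sym N)                   ≡⟨ ∑-cong (Sym N) (λ τ∈ → sym (α-V-max∷ t (∈-Sym⁻ N τ∈) (s≤s z≤n))) ⟩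
  ∑ (λ τ → α t t (+ 1) (+ 1) (V n (n ∷ τ))) (Sym N)   ≡⟨ ∑-Sym′ N (α t t (+ 1) (+ 1) ∘ V n) ⟨
  ∑ (α t t (+ 1) (+ 1) ∘ V n) (Sym' n)                ≡⟨ expansion t t (+ 1) (+ 1) ⟩
  sumK n (λ k → c k * (+ 1 * t) ^ k * (+ 1 + t) ^ (n ∸ 2 *ℕ k))
    ≡⟨ cong (λ u → sumK n (λ k → c k * u ^ k * (+ 1 + t) ^ (n ∸ 2 *ℕ k))) (ℤ.*-identityˡ t) ⟩
  sumK n (λ k → c k * t ^ k * (+ 1 + t) ^ (n ∸ 2 *ℕ k)) ∎
  where
  open ≡-Reasoning
  N = suc q
  n = suc N

-- A sign-reversing involution

Odd : ℕ → Set
Odd n = ∃[ k ] n ≡ suc (k +ℕ k)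

Odd-+-double : ∀ {x} c → Odd x → Odd (x +ℕ (c +ℕ c))
Odd-+-double c (k , refl) = k +ℕ c , cong suc (lemma k c)
  where
  lemma : ∀ k c → (k +ℕ k) +ℕ (c +ℕ c) ≡ (k +ℕ c) +ℕ (k +ℕ c)
  lemma = ℕ-Solver.solve-∀

Odd-+ʳ : ∀ p q c → Odd (p +ℕ q) → Odd ((p +ℕ c) +ℕ (q +ℕ c))
Odd-+ʳ p q c odd = subst Odd (lemma p q c) (Odd-+-double c odd)
  where
  lemma : ∀ p q c → (p +ℕ q) +ℕ (c +ℕ c) ≡ (p +ℕ c) +ℕ (q +ℕ c)
  lemma = ℕ-Solver.solve-∀

Odd-suc-+ˡ : ∀ p q c → Odd (p +ℕ q) → Odd ((c +ℕ suc p) +ℕ (c +ℕ suc q))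
Odd-suc-+ˡ p q c odd = subst Odd (lemma p q c) (Odd-+-double (suc c) odd)
  where
  lemma : ∀ p q c → (p +ℕ q) +ℕ (suc c +ℕ suc c) ≡ (c +ℕ suc p) +ℕ (c +ℕ suc q)
  lemma = ℕ-Solver.solve-∀

evenᵇ-double : ∀ k → evenᵇ (k +ℕ k) ≡ true
evenᵇ-double zero = refl
evenᵇ-double (suc k) rewrite ℕ.+-suc k k = evenᵇ-double k

evenᵇ-odd : ∀ {n} → Odd n → evenᵇ n ≡ false
evenᵇ-odd (zero , refl) = refl
evenᵇ-odd (suc k , refl) rewrite ℕ.+-suc k k = evenᵇ-odd (k , refl)

¬Odd-double : ∀ k → ¬ Odd (k +ℕ k)
¬Odd-double k odd with trans (sym (evenᵇ-double k)) (evenᵇ-odd odd)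
... | ()

evenᵇ-false⇒Odd : ∀ n → evenᵇ n ≡ false → Odd n
evenᵇ-false⇒Odd (suc zero) _ = 0 , refl
evenᵇ-false⇒Odd (suc (suc n)) e with evenᵇ-false⇒Odd n e
... | k , refl = suc k , cong (suc ∘ suc) (sym (ℕ.+-suc k k))

double-injective : ∀ a b → a +ℕ a ≡ b +ℕ b → a ≡ b
double-injective zero zero _ = refl
double-injective (suc a) (suc b) eq rewrite ℕ.+-suc a a | ℕ.+-suc b b =
  cong suc (double-injective a b (ℕ.suc-injective (ℕ.suc-injective eq)))

-1^-double : ∀ k → -1ℤ ^ (k +ℕ k) ≡ + 1
-1^-double zero = refl
-1^-double (suc k) rewrite ℕ.+-suc k k | -1^-double k = refl

-1^-Odd : ∀ x y → Odd (x +ℕ y) → -1ℤ ^ x ≡ - (-1ℤ ^ y)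
-1^-Odd x y (k , x+y≡) = begin
  -1ℤ ^ x                             ≡⟨ sym (trans (cong (_*_ (-1ℤ ^ x)) (-1^-double y)) (ℤ.*-identityʳ _)) ⟩
  -1ℤ ^ x * -1ℤ ^ (y +ℕ y)            ≡⟨ cong (_*_ (-1ℤ ^ x)) (ℤ.^-distribˡ-+-* -1ℤ y y) ⟩
  -1ℤ ^ x * (-1ℤ ^ y * -1ℤ ^ y)       ≡⟨ sym (ℤ.*-assoc (-1ℤ ^ x) _ _) ⟩
  -1ℤ ^ x * -1ℤ ^ y * -1ℤ ^ y         ≡⟨ cong (_* -1ℤ ^ y) (sym (ℤ.^-distribˡ-+-* -1ℤ x y)) ⟩
  -1ℤ ^ (x +ℕ y) * -1ℤ ^ y            ≡⟨ cong (λ e → -1ℤ ^ e * -1ℤ ^ y) x+y≡ ⟩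
  -1ℤ * -1ℤ ^ (k +ℕ k) * -1ℤ ^ y      ≡⟨ cong (λ s → -1ℤ * s * -1ℤ ^ y) (-1^-double k) ⟩
  -1ℤ * + 1 * -1ℤ ^ y                 ≡⟨ ℤ.-1*i≡-i (-1ℤ ^ y) ⟩
  - (-1ℤ ^ y)                         ∎
  where open ≡-Reasoning

asc-∷ʳ-∷ʳ : ∀ w y v → asc (w ∷ʳ y ∷ʳ v) ≡ asc (w ∷ʳ y) +ℕ bit (y ≤ᵇ v)
asc-∷ʳ-∷ʳ [] y v = ℕ.+-identityʳ _
asc-∷ʳ-∷ʳ (x ∷ []) y v = lemma (bit (x ≤ᵇ y)) (bit (y ≤ᵇ v))
  where
  lemma : ∀ p q → p +ℕ (q +ℕ 0) ≡ (p +ℕ 0) +ℕ q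
  lemma = ℕ-Solver.solve-∀
asc-∷ʳ-∷ʳ (x ∷ x′ ∷ w) y v = trans (cong (bit (x ≤ᵇ x′) +ℕ_) (asc-∷ʳ-∷ʳ (x′ ∷ w) y v)) (sym (ℕ.+-assoc (bit (x ≤ᵇ x′)) _ _))

bit-≤ᵇ-both : ∀ {x y} → x ≢ y → bit (y ≤ᵇ x) +ℕ bit (x ≤ᵇ y) ≡ 1
bit-≤ᵇ-both {x} {y} x≢y with ℕ.<-cmp x y
... | tri< x<y _ _ rewrite ≤ᵇ-false x<y | ≤ᵇ-true (ℕ.<⇒≤ x<y) = refl
... | tri≈ _ x≡y _ = ⊥-elim (x≢y x≡y)
... | tri> _ _ y<x rewrite ≤ᵇ-false y<x | ≤ᵇ-true (ℕ.<⇒≤ y<x) = refl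

asc-reverse : ∀ x xs → Unique (x ∷ xs) → asc (reverse (x ∷ xs)) +ℕ asc (x ∷ xs) ≡ length xs
asc-reverse x [] _ = refl
asc-reverse x (y ∷ r) ((x≢y ∷ _) ∷ u) = begin
  asc (reverse (x ∷ y ∷ r)) +ℕ (bit (x ≤ᵇ y) +ℕ asc (y ∷ r))
    ≡⟨ cong (λ w → asc w +ℕ (bit (x ≤ᵇ y) +ℕ asc (y ∷ r))) (trans (unfold-reverse x (y ∷ r)) (cong (_∷ʳ x) (unfold-reverse y r))) ⟩
  asc (reverse r ∷ʳ y ∷ʳ x) +ℕ (bit (x ≤ᵇ y) +ℕ asc (y ∷ r))
    ≡⟨ cong (_+ℕ (bit (x ≤ᵇ y) +ℕ asc (y ∷ r))) (asc-∷ʳ-∷ʳ (reverse r) y x) ⟩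
  (asc (reverse r ∷ʳ y) +ℕ bit (y ≤ᵇ x)) +ℕ (bit (x ≤ᵇ y) +ℕ asc (y ∷ r))
    ≡⟨ regroup (asc (reverse r ∷ʳ y)) (bit (y ≤ᵇ x)) (bit (x ≤ᵇ y)) (asc (y ∷ r)) ⟩
  (asc (reverse r ∷ʳ y) +ℕ asc (y ∷ r)) +ℕ (bit (y ≤ᵇ x) +ℕ bit (x ≤ᵇ y))
    ≡⟨ cong₂ _+ℕ_ (trans (cong (λ w → asc w +ℕ asc (y ∷ r)) (sym (unfold-reverse y r))) (asc-reverse y r u)) (bit-≤ᵇ-both x≢y) ⟩
  length r +ℕ 1
    ≡⟨ ℕ.+-comm (length r) 1 ⟩
  suc (length r) ∎
  where
  open ≡-Reasoning
  regroup : ∀ p q r s → (p +ℕ q) +ℕ (r +ℕ s) ≡ (p +ℕ s) +ℕ (q +ℕ r)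
  regroup = ℕ-Solver.solve-∀

reverse-moves : ∀ x xs → Unique (x ∷ xs) → Odd (length xs) → reverse (x ∷ xs) ≢ x ∷ xs
reverse-moves x xs u odd rev≡ =
  ¬Odd-double (asc (x ∷ xs)) (subst Odd (trans (sym (asc-reverse x xs u)) (cong (λ w → asc w +ℕ asc (x ∷ xs)) rev≡)) odd)

asc-∷ʳ-min : ∀ {μ} a → All (μ <_) a → asc (a ∷ʳ μ) ≡ asc a
asc-∷ʳ-min [] _ = refl
asc-∷ʳ-min {μ} (x ∷ a) μ<a = trans (asc-∷ʳ x a μ)
  (trans (cong (λ b → asc (x ∷ a) +ℕ bit b) (≤ᵇ-false (All.lookup μ<a (last′∈ x a)))) (ℕ.+-identityʳ _))

asc-++-∷ : ∀ xs y ys → asc (xs ++ y ∷ ys) ≡ asc (xs ∷ʳ y) +ℕ asc (y ∷ ys)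
asc-++-∷ [] y ys = refl
asc-++-∷ (x ∷ []) y ys = cong (_+ℕ asc (y ∷ ys)) (sym (ℕ.+-identityʳ (bit (x ≤ᵇ y))))
asc-++-∷ (x ∷ x′ ∷ xs) y ys = trans (cong (bit (x ≤ᵇ x′) +ℕ_) (asc-++-∷ (x′ ∷ xs) y ys)) (sym (ℕ.+-assoc (bit (x ≤ᵇ x′)) _ _))

asc-around : ∀ {μ} a b → All (μ <_) a → asc (a ++ μ ∷ b) ≡ asc a +ℕ asc (μ ∷ b)
asc-around {μ} a b μ<a = trans (asc-++-∷ a μ b) (cong (_+ℕ asc (μ ∷ b)) (asc-∷ʳ-min a μ<a))

asc-min∷ : ∀ {μ} b → 0 < length b → All (μ <_) b → asc (μ ∷ b) ≡ suc (asc b)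
asc-min∷ (y ∷ ys) _ (μ<y ∷ _) rewrite ≤ᵇ-true (ℕ.<⇒≤ μ<y) = refl

Split : Set
Split = List ℕ × ℕ × List ℕ

unsplit : Split → List ℕ
unsplit (a , μ , b) = a ++ μ ∷ b

IsMinSplit : Split → Set
IsMinSplit (a , μ , b) = All (μ <_) a × All (μ <_) b

consSplit : ℕ → List ℕ → Split → Split
consSplit x l (a , μ , b) = if x <ᵇ μ then ([] , x , l) else (x ∷ a , μ , b)

splitAtMin : List ℕ → Split
splitAtMin []          = [] , 0 , []
splitAtMin (x ∷ [])    = [] , x , []
splitAtMin (x ∷ y ∷ r) = consSplit x (y ∷ r) (splitAtMin (y ∷ r))

splitAtMin-min∈ : ∀ y r → proj₁ (proj₂ (splitAtMin (y ∷ r))) ∈ y ∷ r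
splitAtMin-min∈ y [] = here refl
splitAtMin-min∈ y (z ∷ r) with splitAtMin (z ∷ r) | splitAtMin-min∈ z r
... | _ , μ , _ | μ∈ with y <ᵇ μ
...   | true  = here refl
...   | false = there μ∈

splitAtMin-++ : ∀ a μ b → All (μ <_) a → All (μ <_) b → splitAtMin (a ++ μ ∷ b) ≡ (a , μ , b)
splitAtMin-++ [] μ [] _ _ = refl
splitAtMin-++ [] μ (y ∷ r) _ μ<b with splitAtMin (y ∷ r) | splitAtMin-min∈ y r
... | _ , μ′ , _ | μ′∈ rewrite <ᵇ-true (All.lookup μ<b μ′∈) = refl
splitAtMin-++ (x ∷ []) μ b (μ<x ∷ []) μ<b rewrite splitAtMin-++ [] μ b [] μ<b | <ᵇ-false (ℕ.<⇒≤ μ<x) = refl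
splitAtMin-++ (x ∷ x′ ∷ a) μ b (μ<x ∷ μ<a) μ<b rewrite splitAtMin-++ (x′ ∷ a) μ b μ<a μ<b | <ᵇ-false (ℕ.<⇒≤ μ<x) = refl

splitAtMin-unsplit : ∀ x xs → unsplit (splitAtMin (x ∷ xs)) ≡ x ∷ xs
splitAtMin-unsplit x [] = refl
splitAtMin-unsplit x (y ∷ r) with splitAtMin (y ∷ r) | splitAtMin-unsplit y r
... | a , μ , b | eq with x <ᵇ μ
...   | true  = refl
...   | false = cong (x ∷_) eq

splitAroundMin : ∀ x xs → Unique (x ∷ xs) → ∃[ s ] unsplit s ≡ x ∷ xs × IsMinSplit s
splitAroundMin x [] _ = ([] , x , []) , refl , [] , []
splitAroundMin x (y ∷ r) (x≢ ∷ u) with splitAroundMin y r u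
... | (a , μ , b) , eq , μ<a , μ<b with ℕ.<-cmp x μ
... | tri< x<μ _ _ = ([] , x , y ∷ r) , refl , [] ,
      subst (All (x <_)) eq (All.++⁺ (All.map (ℕ.<-trans x<μ) μ<a) (x<μ ∷ All.map (ℕ.<-trans x<μ) μ<b))
... | tri≈ _ x≡μ _ = ⊥-elim (All.lookup x≢ (subst (μ ∈_) eq (∈.∈-++⁺ʳ a (here refl))) x≡μ)
... | tri> _ _ μ<x = (x ∷ a , μ , b) , cong (x ∷_) eq , μ<x ∷ μ<a , μ<b

evenPositive : ℕ → Bool
evenPositive zero    = false
evenPositive (suc n) = not (evenᵇ n)

evenPositive⇒Odd : ∀ x (xs : List ℕ) → evenPositive (length (x ∷ xs)) ≡ true → Odd (length xs)
evenPositive⇒Odd x xs e = evenᵇ-false⇒Odd (length xs) (trans (sym (not-involutive _)) (cong not e))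

evenPositive-↭ : ∀ {l l′ : List ℕ} → l ↭ l′ → evenPositive (length l) ≡ evenPositive (length l′)
evenPositive-↭ p = cong evenPositive (↭.↭-length p)

isEmpty : List ℕ → Bool
isEmpty l = length l ≡ᵇ 0

isEmpty-↭ : ∀ {l l′ : List ℕ} → l ↭ l′ → isEmpty l ≡ isEmpty l′
isEmpty-↭ p = cong (_≡ᵇ 0) (↭.↭-length p)

-- ι f is the involution on words of length at most f; the fuel f only bounds the recursion.
mutual
  ι : ℕ → List ℕ → List ℕ
  ι zero    σ        = σ
  ι (suc f) []       = []
  ι (suc f) (x ∷ xs) = unsplit (ιSplit f (splitAtMin (x ∷ xs)))

  ιSplit : ℕ → Split → Split
  ιSplit f (a , μ , b) =
    if evenPositive (length a) then (reverse a , μ , b)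
    else if evenPositive (length b) then (a , μ , reverse b)
    else if isEmpty a ∨ isEmpty b then (b , μ , a)
    else if isFixed f a then (a , μ , ι f b)
    else (ι f a , μ , b)

  isFixed : ℕ → List ℕ → Bool
  isFixed f a = does (≡-dec ℕ._≟_ (ι f a) a)

data ιSplitCase (f : ℕ) (a : List ℕ) (μ : ℕ) (b : List ℕ) : Split → Set where
  reverseLeft  : evenPositive (length a) ≡ true → ιSplitCase f a μ b (reverse a , μ , b)
  reverseRight : evenPositive (length a) ≡ false → evenPositive (length b) ≡ true → ιSplitCase f a μ b (a , μ , reverse b)
  swap         : evenPositive (length a) ≡ false → evenPositive (length b) ≡ false → (isEmpty a ∨ isEmpty b) ≡ true →
                 ιSplitCase f a μ b (b , μ , a)
  recurseRight : evenPositive (length a) ≡ false → evenPositive (length b) ≡ false → (isEmpty a ∨ isEmpty b) ≡ false →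
                 ι f a ≡ a → ιSplitCase f a μ b (a , μ , ι f b)
  recurseLeft  : evenPositive (length a) ≡ false → evenPositive (length b) ≡ false → (isEmpty a ∨ isEmpty b) ≡ false →
                 ι f a ≢ a → ιSplitCase f a μ b (ι f a , μ , b)

ιSplit-case : ∀ f a μ b → ιSplitCase f a μ b (ιSplit f (a , μ , b))
ιSplit-case f a μ b with evenPositive (length a) in ea
... | true = reverseLeft ea
... | false with evenPositive (length b) in eb
...   | true = reverseRight ea eb
...   | false with isEmpty a ∨ isEmpty b in e∅
...     | true = swap ea eb e∅
...     | false with ≡-dec ℕ._≟_ (ι f a) a
...       | yes fixed = recurseRight ea eb e∅ fixed
...       | no moved  = recurseLeft ea eb e∅ moved

ι-around : ∀ f s → IsMinSplit s → ι (suc f) (unsplit s) ≡ unsplit (ιSplit f s)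
ι-around f ([]    , μ , b) (μ<a , μ<b) = cong (unsplit ∘ ιSplit f) (splitAtMin-++ [] μ b μ<a μ<b)
ι-around f (x ∷ a , μ , b) (μ<a , μ<b) = cong (unsplit ∘ ιSplit f) (splitAtMin-++ (x ∷ a) μ b μ<a μ<b)

ιSplit-↭ : ∀ f a μ b → (∀ l → ι f l ↭ l) → unsplit (ιSplit f (a , μ , b)) ↭ a ++ μ ∷ b
ιSplit-↭ f a μ b ι↭ with ιSplit f (a , μ , b) | ιSplit-case f a μ b
... | _ | reverseLeft _         = ↭.++⁺ʳ (μ ∷ b) (↭.↭-reverse a)
... | _ | reverseRight _ _      = ↭.++⁺ˡ a (↭-prep μ (↭.↭-reverse b))
... | _ | swap _ _ _            = ↭-trans (↭.++-comm b (μ ∷ a)) (↭-sym (↭.shift μ a b))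
... | _ | recurseRight _ _ _ _  = ↭.++⁺ˡ a (↭-prep μ (ι↭ b))
... | _ | recurseLeft _ _ _ _   = ↭.++⁺ʳ (μ ∷ b) (ι↭ a)

ι-↭ : ∀ f σ → ι f σ ↭ σ
ι-↭ zero σ = ↭-refl
ι-↭ (suc f) [] = ↭-refl
ι-↭ (suc f) (x ∷ xs) with splitAtMin (x ∷ xs) | splitAtMin-unsplit x xs
... | a , μ , b | eq = ↭-trans (ιSplit-↭ f a μ b (ι-↭ f)) (↭-reflexive eq)

ιSplit-IsMinSplit : ∀ f s → IsMinSplit s → IsMinSplit (ιSplit f s)
ιSplit-IsMinSplit f (a , μ , b) (μ<a , μ<b) with ιSplit f (a , μ , b) | ιSplit-case f a μ b
... | _ | reverseLeft _         = ↭.All-resp-↭ (↭-sym (↭.↭-reverse a)) μ<a , μ<b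
... | _ | reverseRight _ _      = μ<a , ↭.All-resp-↭ (↭-sym (↭.↭-reverse b)) μ<b
... | _ | swap _ _ _            = μ<b , μ<a
... | _ | recurseRight _ _ _ _  = μ<a , ↭.All-resp-↭ (↭-sym (ι-↭ f b)) μ<b
... | _ | recurseLeft _ _ _ _   = ↭.All-resp-↭ (↭-sym (ι-↭ f a)) μ<a , μ<b

ιSplit-involutive : ∀ f a μ b → ι f (ι f a) ≡ a → ι f (ι f b) ≡ b →
                    ιSplit f (ιSplit f (a , μ , b)) ≡ (a , μ , b)
ιSplit-involutive f a μ b ιιa ιιb with ιSplit f (a , μ , b) | ιSplit-case f a μ b
... | _ | reverseLeft ea
  rewrite evenPositive-↭ (↭.↭-reverse a) | ea | reverse-involutive a = refl
... | _ | reverseRight ea eb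
  rewrite ea | evenPositive-↭ (↭.↭-reverse b) | eb | reverse-involutive b = refl
... | _ | swap ea eb e∅
  rewrite eb | ea | ∨-comm (isEmpty b) (isEmpty a) | e∅ = refl
... | _ | recurseRight ea eb e∅ fixed
  rewrite ea | evenPositive-↭ (ι-↭ f b) | eb | isEmpty-↭ (ι-↭ f b) | e∅
  with ≡-dec ℕ._≟_ (ι f a) a
...   | yes _ = cong (λ b′ → a , μ , b′) ιιb
...   | no moved = ⊥-elim (moved fixed)
ιSplit-involutive f a μ b ιιa ιιb | _ | recurseLeft ea eb e∅ moved
  rewrite evenPositive-↭ (ι-↭ f a) | ea | eb | isEmpty-↭ (ι-↭ f a) | e∅
  with ≡-dec ℕ._≟_ (ι f (ι f a)) (ι f a)
...   | yes ιιa≡ιa = ⊥-elim (moved (trans (sym ιιa≡ιa) ιιa))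
...   | no _ = cong (λ a′ → a′ , μ , b) ιιa

Small : ℕ → List ℕ → Set
Small f l = Unique l × length l ≤ f

parts-Small : ∀ f a μ b → Small (suc f) (a ++ μ ∷ b) → Small f a × Small f b
parts-Small f a μ b (u , len) with Unique-++⁻ a u
... | ua , _ ∷ ub = (ua , ℕ.≤-pred (ℕ.≤-trans (s≤s (ℕ.m≤m+n _ _)) len′))
                  , (ub , ℕ.≤-pred (ℕ.≤-trans (s≤s (ℕ.m≤n+m _ _)) len′))
  where
  len′ : suc (length a +ℕ length b) ≤ suc f
  len′ = subst (_≤ suc f) (trans (length-++ a) (ℕ.+-suc (length a) (length b))) len

ι-involutive : ∀ f σ → Small f σ → ι f (ι f σ) ≡ σ
ι-involutive zero σ _ = refl
ι-involutive (suc f) [] _ = refl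
ι-involutive (suc f) (x ∷ xs) small with splitAroundMin x xs (proj₁ small)
... | s@(a , μ , b) , s≡ , min with parts-Small f a μ b (subst (Small (suc f)) (sym s≡) small)
... | small-a , small-b = begin
  ι (suc f) (ι (suc f) (x ∷ xs))     ≡⟨ cong (ι (suc f) ∘ ι (suc f)) (sym s≡) ⟩
  ι (suc f) (ι (suc f) (unsplit s))  ≡⟨ cong (ι (suc f)) (ι-around f s min) ⟩
  ι (suc f) (unsplit (ιSplit f s))   ≡⟨ ι-around f (ιSplit f s) (ιSplit-IsMinSplit f s min) ⟩
  unsplit (ιSplit f (ιSplit f s))    ≡⟨ cong unsplit (ιSplit-involutive f a μ b (ι-involutive f a small-a) (ι-involutive f b small-b)) ⟩
  unsplit s                          ≡⟨ s≡ ⟩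
  x ∷ xs                             ∎
  where open ≡-Reasoning

ιSplit-Odd : ∀ f a μ b → IsMinSplit (a , μ , b) → Unique (a ++ μ ∷ b) →
             (ι f a ≢ a → Odd (asc (ι f a) +ℕ asc a)) → (ι f b ≢ b → Odd (asc (ι f b) +ℕ asc b)) →
             unsplit (ιSplit f (a , μ , b)) ≢ a ++ μ ∷ b →
             Odd (asc (unsplit (ιSplit f (a , μ , b))) +ℕ asc (a ++ μ ∷ b))
ιSplit-Odd f a μ b min u oddA oddB moved
  with ιSplit f (a , μ , b) | ιSplit-case f a μ b | ιSplit-IsMinSplit f (a , μ , b) min
... | _ | reverseLeft ea | μ<ra , _ with a | Unique-++⁻ a u
...   | x ∷ xs | ua , _ rewrite asc-around (reverse (x ∷ xs)) b μ<ra | asc-around (x ∷ xs) b (proj₁ min) =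
  Odd-+ʳ (asc (reverse (x ∷ xs))) (asc (x ∷ xs)) (asc (μ ∷ b)) (subst Odd (sym (asc-reverse x xs ua)) (evenPositive⇒Odd x xs ea))
ιSplit-Odd f a μ b min u oddA oddB moved | _ | reverseRight ea eb | _ , μ<rb with b | Unique-++⁻ a u
... | y ∷ ys | _ , _ ∷ ub
  rewrite asc-around a (reverse (y ∷ ys)) (proj₁ min) | asc-around a (y ∷ ys) (proj₁ min)
        | asc-min∷ (reverse (y ∷ ys)) (subst (0 <_) (sym (length-reverse (y ∷ ys))) (s≤s z≤n)) μ<rb
        | asc-min∷ (y ∷ ys) (s≤s z≤n) (proj₂ min) =
  Odd-suc-+ˡ (asc (reverse (y ∷ ys))) (asc (y ∷ ys)) (asc a) (subst Odd (sym (asc-reverse y ys ub)) (evenPositive⇒Odd y ys eb))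
ιSplit-Odd f a μ b min u oddA oddB moved | _ | swap _ _ e∅ | _ with a | b
... | [] | [] = ⊥-elim (moved refl)
... | [] | y ∷ ys rewrite asc-∷ʳ-min (y ∷ ys) (proj₂ min) | asc-min∷ (y ∷ ys) (s≤s z≤n) (proj₂ min) =
  asc (y ∷ ys) , ℕ.+-suc (asc (y ∷ ys)) (asc (y ∷ ys))
... | x ∷ xs | [] rewrite asc-∷ʳ-min (x ∷ xs) (proj₁ min) | asc-min∷ (x ∷ xs) (s≤s z≤n) (proj₁ min) =
  asc (x ∷ xs) , refl
ιSplit-Odd f a μ b min u oddA oddB moved | _ | recurseRight _ _ e∅ _ | _ , μ<ιb with a | b
... | x ∷ xs | y ∷ ys
  rewrite asc-around (x ∷ xs) (ι f (y ∷ ys)) (proj₁ min) | asc-around (x ∷ xs) (y ∷ ys) (proj₁ min)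
        | asc-min∷ (ι f (y ∷ ys)) (subst (0 <_) (sym (↭.↭-length (ι-↭ f (y ∷ ys)))) (s≤s z≤n)) μ<ιb
        | asc-min∷ (y ∷ ys) (s≤s z≤n) (proj₂ min) =
  Odd-suc-+ˡ (asc (ι f (y ∷ ys))) (asc (y ∷ ys)) (asc (x ∷ xs)) (oddB (moved ∘ cong ((x ∷ xs) ++_) ∘ cong (μ ∷_)))
ιSplit-Odd f a μ b min u oddA oddB moved | _ | recurseLeft _ _ _ movedA | μ<ιa , _
  rewrite asc-around (ι f a) b μ<ιa | asc-around a b (proj₁ min) =
  Odd-+ʳ (asc (ι f a)) (asc a) (asc (μ ∷ b)) (oddA movedA)

ι-changes-parity : ∀ f σ → Small f σ → ι f σ ≢ σ → Odd (asc (ι f σ) +ℕ asc σ)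
ι-changes-parity zero σ _ moved = ⊥-elim (moved refl)
ι-changes-parity (suc f) [] _ moved = ⊥-elim (moved refl)
ι-changes-parity (suc f) (x ∷ xs) small moved with splitAroundMin x xs (proj₁ small)
... | s@(a , μ , b) , s≡ , min with parts-Small f a μ b (subst (Small (suc f)) (sym s≡) small)
... | small-a , small-b =
  subst (λ σ → Odd (asc (ι (suc f) σ) +ℕ asc σ)) s≡
    (subst (λ l → Odd (asc l +ℕ asc (unsplit s))) (sym (ι-around f s min))
      (ιSplit-Odd f a μ b min (subst Unique (sym s≡) (proj₁ small))
        (ι-changes-parity f a small-a) (ι-changes-parity f b small-b)
        (λ fixed → moved (subst (λ σ → ι (suc f) σ ≡ σ) s≡ (trans (ι-around f s min) fixed)))))

-- Down-up permutations

data DownUp : List ℕ → Set where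
  single : ∀ x → DownUp [ x ]
  valley : ∀ {x y z r} → y < x → y < z → DownUp (z ∷ r) → DownUp (x ∷ y ∷ z ∷ r)

DownUp-length : ∀ {σ} → DownUp σ → length σ ≡ suc (asc σ +ℕ asc σ)
DownUp-length (single x) = refl
DownUp-length (valley {x} {y} {z} {r} y<x y<z du)
  rewrite ≤ᵇ-false y<x | ≤ᵇ-true (ℕ.<⇒≤ y<z) | DownUp-length du =
  cong (suc ∘ suc) (sym (ℕ.+-suc (asc (z ∷ r)) (asc (z ∷ r))))

DownUp-odd : ∀ {σ} → DownUp σ → evenᵇ (length σ) ≡ false
DownUp-odd {σ} du = evenᵇ-odd (asc σ , DownUp-length du)

DownUp-evenPositive : ∀ {σ} → DownUp σ → evenPositive (length σ) ≡ false
DownUp-evenPositive {σ} du rewrite DownUp-length du = cong not (evenᵇ-double (asc σ))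

DownUp≢[] : ∀ {σ} → DownUp σ → σ ≢ []
DownUp≢[] (single _) ()
DownUp≢[] (valley _ _ _) ()

DownUp-join : ∀ {a μ b} → DownUp a → DownUp b → IsMinSplit (a , μ , b) → DownUp (a ++ μ ∷ b)
DownUp-join (single x) (single z) (μ<x ∷ [] , μ<z ∷ []) = valley μ<x μ<z (single z)
DownUp-join (single x) (valley y<z y<w du) (μ<x ∷ [] , μ<z ∷ _) = valley μ<x μ<z (valley y<z y<w du)
DownUp-join (valley y<x y<z du) dub (_ ∷ _ ∷ μ<a , μ<b) = valley y<x y<z (DownUp-join du dub (μ<a , μ<b))

DownUp-split : ∀ a μ b → IsMinSplit (a , μ , b) → DownUp (a ++ μ ∷ b) → (a ≡ [] × b ≡ []) ⊎ (DownUp a × DownUp b)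
DownUp-split [] μ [] _ _ = inj₁ (refl , refl)
DownUp-split [] μ (y ∷ z ∷ r) (_ , μ<y ∷ _) (valley y<μ _ _) = ⊥-elim (ℕ.<-asym μ<y y<μ)
DownUp-split (x ∷ []) μ (z ∷ r) _ (valley _ _ du) = inj₂ (single x , du)
DownUp-split (x ∷ y ∷ []) μ b (_ ∷ μ<y ∷ [] , _) (valley _ y<μ _) = ⊥-elim (ℕ.<-asym μ<y y<μ)
DownUp-split (x ∷ y ∷ z ∷ a) μ b (_ ∷ _ ∷ μ<a , μ<b) (valley y<x y<z du) with DownUp-split (z ∷ a) μ b (μ<a , μ<b) du
... | inj₂ (dua , dub) = inj₂ (valley y<x y<z dua , dub)

isEmpty-∨≡false⁻ : ∀ {a b : List ℕ} → (isEmpty a ∨ isEmpty b) ≡ false → a ≢ [] × b ≢ []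
isEmpty-∨≡false⁻ {[]} ()
isEmpty-∨≡false⁻ {_ ∷ _} {[]} ()
isEmpty-∨≡false⁻ {_ ∷ _} {_ ∷ _} _ = (λ ()) , (λ ())

isEmpty-∨≡false⁺ : ∀ {a b : List ℕ} → a ≢ [] → b ≢ [] → (isEmpty a ∨ isEmpty b) ≡ false
isEmpty-∨≡false⁺ {[]} a≢[] _ = ⊥-elim (a≢[] refl)
isEmpty-∨≡false⁺ {_ ∷ _} {[]} _ b≢[] = ⊥-elim (b≢[] refl)
isEmpty-∨≡false⁺ {_ ∷ _} {_ ∷ _} _ _ = refl

fixedSplit⇒DownUp : ∀ f a μ b → IsMinSplit (a , μ , b) → Unique (a ++ μ ∷ b) →
                    (a ≢ [] → ι f a ≡ a → DownUp a) → (b ≢ [] → ι f b ≡ b → DownUp b) →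
                    unsplit (ιSplit f (a , μ , b)) ≡ a ++ μ ∷ b → DownUp (a ++ μ ∷ b)
fixedSplit⇒DownUp f a μ b min u downUpA downUpB fixed with ιSplit f (a , μ , b) | ιSplit-case f a μ b
... | _ | reverseLeft ea with a | Unique-++⁻ a u
...   | x ∷ xs | ua , _ = ⊥-elim (reverse-moves x xs ua (evenPositive⇒Odd x xs ea) (++-cancelʳ (μ ∷ b) _ _ fixed))
fixedSplit⇒DownUp f a μ b min u downUpA downUpB fixed | _ | reverseRight _ eb with b | Unique-++⁻ a u
... | y ∷ ys | _ , _ ∷ ub = ⊥-elim (reverse-moves y ys ub (evenPositive⇒Odd y ys eb) (∷-injectiveʳ (++-cancelˡ a _ _ fixed)))
fixedSplit⇒DownUp f a μ b (μ<a , μ<b) u downUpA downUpB fixed | _ | swap _ _ _ with a | b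
... | [] | [] = single μ
... | [] | y ∷ ys = ⊥-elim (ℕ.<-irrefl (sym (∷-injectiveˡ fixed)) (All.head μ<b))
... | x ∷ xs | [] = ⊥-elim (ℕ.<-irrefl (∷-injectiveˡ fixed) (All.head μ<a))
fixedSplit⇒DownUp f a μ b min u downUpA downUpB fixed | _ | recurseRight _ _ e∅ fixedA =
  DownUp-join (downUpA (proj₁ (isEmpty-∨≡false⁻ {a} {b} e∅)) fixedA)
              (downUpB (proj₂ (isEmpty-∨≡false⁻ {a} {b} e∅)) (∷-injectiveʳ (++-cancelˡ a _ _ fixed))) min
fixedSplit⇒DownUp f a μ b min u downUpA downUpB fixed | _ | recurseLeft _ _ _ movedA =
  ⊥-elim (movedA (++-cancelʳ (μ ∷ b) _ _ fixed))

fixed⇒DownUp : ∀ f σ → Small f σ → σ ≢ [] → ι f σ ≡ σ → DownUp σ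
fixed⇒DownUp zero [] _ nonempty _ = ⊥-elim (nonempty refl)
fixed⇒DownUp zero (x ∷ xs) (_ , ()) _ _
fixed⇒DownUp (suc f) [] _ nonempty _ = ⊥-elim (nonempty refl)
fixed⇒DownUp (suc f) (x ∷ xs) small _ fixed with splitAroundMin x xs (proj₁ small)
... | s@(a , μ , b) , s≡ , min with parts-Small f a μ b (subst (Small (suc f)) (sym s≡) small)
... | small-a , small-b = subst DownUp s≡
  (fixedSplit⇒DownUp f a μ b min (subst Unique (sym s≡) (proj₁ small))
    (fixed⇒DownUp f a small-a) (fixed⇒DownUp f b small-b)
    (trans (sym (ι-around f s min)) (trans (cong (ι (suc f)) s≡) (trans fixed (sym s≡)))))

DownUpSplit⇒fixed : ∀ f a μ b → DownUp a → DownUp b → ι f a ≡ a → ι f b ≡ b →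
                    ιSplit f (a , μ , b) ≡ (a , μ , b)
DownUpSplit⇒fixed f a μ b dua dub fixedA fixedB with ιSplit f (a , μ , b) | ιSplit-case f a μ b
... | _ | reverseLeft ea = ⊥-elim (true≢false (trans (sym ea) (DownUp-evenPositive dua)))
... | _ | reverseRight _ eb = ⊥-elim (true≢false (trans (sym eb) (DownUp-evenPositive dub)))
... | _ | swap _ _ e∅ = ⊥-elim (true≢false (trans (sym e∅) (isEmpty-∨≡false⁺ (DownUp≢[] dua) (DownUp≢[] dub))))
... | _ | recurseRight _ _ _ _ = cong (λ b′ → a , μ , b′) fixedB
... | _ | recurseLeft _ _ _ movedA = ⊥-elim (movedA fixedA)

DownUp⇒fixed : ∀ f σ → Small f σ → DownUp σ → ι f σ ≡ σ
DownUp⇒fixed zero σ _ _ = refl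
DownUp⇒fixed (suc f) [] _ _ = refl
DownUp⇒fixed (suc f) (x ∷ xs) small du with splitAroundMin x xs (proj₁ small)
... | s@(a , μ , b) , s≡ , min
  with parts-Small f a μ b (subst (Small (suc f)) (sym s≡) small) | DownUp-split a μ b min (subst DownUp (sym s≡) du)
... | _ | inj₁ (refl , refl) = trans (cong (ι (suc f)) (sym s≡)) (trans (ι-around f s min) s≡)
... | small-a , small-b | inj₂ (dua , dub) = begin
  ι (suc f) (x ∷ xs)     ≡⟨ cong (ι (suc f)) (sym s≡) ⟩
  ι (suc f) (unsplit s)  ≡⟨ ι-around f s min ⟩
  unsplit (ιSplit f s)   ≡⟨ cong unsplit (DownUpSplit⇒fixed f a μ b dua dub (DownUp⇒fixed f a small-a dua) (DownUp⇒fixed f b small-b dub)) ⟩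
  unsplit s              ≡⟨ s≡ ⟩
  x ∷ xs                 ∎
  where open ≡-Reasoning

valleyAt : List ℕ → ℕ → Bool
valleyAt σ k = (at σ k <ᵇ at σ (k ∸ 1)) ∧ (at σ k <ᵇ at σ (suc k))

EvenValleys : List ℕ → Set
EvenValleys σ = ∀ j → 1 ≤ j → 2 *ℕ j ≤ length σ ∸ 1 → T (valleyAt σ (2 *ℕ j))

2*suc : ∀ j → 2 *ℕ suc j ≡ suc (suc (2 *ℕ j))
2*suc j = ℕ.*-suc 2 j

valleyAt-drop2 : ∀ x y w j → valleyAt (x ∷ y ∷ w) (2 *ℕ suc (suc j)) ≡ valleyAt w (2 *ℕ suc j)
valleyAt-drop2 x y w j = begin
  valleyAt (x ∷ y ∷ w) (2 *ℕ suc (suc j))                ≡⟨ cong (valleyAt (x ∷ y ∷ w)) (trans (2*suc (suc j)) (cong (suc ∘ suc) (2*suc j))) ⟩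
  valleyAt (x ∷ y ∷ w) (suc (suc (suc (suc (2 *ℕ j)))))  ≡⟨⟩
  valleyAt w (suc (suc (2 *ℕ j)))                        ≡⟨ cong (valleyAt w) (2*suc j) ⟨
  valleyAt w (2 *ℕ suc j)                                ∎
  where open ≡-Reasoning

EvenValleys-drop2 : ∀ x y z r → EvenValleys (x ∷ y ∷ z ∷ r) → EvenValleys (z ∷ r)
EvenValleys-drop2 x y z r valleys (suc j) _ 2j≤ =
  subst T (valleyAt-drop2 x y (z ∷ r) j)
    (valleys (suc (suc j)) (s≤s z≤n) (subst (_≤ suc (suc (length r))) (sym (2*suc (suc j))) (s≤s (s≤s 2j≤))))

DownUp⇒EvenValleys : ∀ {σ} → DownUp σ → EvenValleys σ
DownUp⇒EvenValleys (single x) (suc j) _ 2j≤0 with subst (_≤ 0) (2*suc j) 2j≤0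
... | ()
DownUp⇒EvenValleys (valley y<x y<z _) (suc zero) _ _ = from T-∧ (ℕ.<⇒<ᵇ y<x , ℕ.<⇒<ᵇ y<z)
DownUp⇒EvenValleys {x ∷ y ∷ z ∷ r} (valley _ _ du) (suc (suc j)) _ 2j≤ =
  subst T (sym (valleyAt-drop2 x y (z ∷ r) j))
    (DownUp⇒EvenValleys du (suc j) (s≤s z≤n) (ℕ.≤-pred (ℕ.≤-pred (subst (_≤ suc (suc (length r))) (2*suc (suc j)) 2j≤))))

EvenValleys⇒DownUp : ∀ σ → evenᵇ (length σ) ≡ false → EvenValleys σ → DownUp σ
EvenValleys⇒DownUp (x ∷ []) _ _ = single x
EvenValleys⇒DownUp (x ∷ y ∷ z ∷ r) odd valleys =
  valley (ℕ.<ᵇ⇒< y x (proj₁ valley₁)) (ℕ.<ᵇ⇒< y z (proj₂ valley₁))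
         (EvenValleys⇒DownUp (z ∷ r) odd (EvenValleys-drop2 x y z r valleys))
  where
  valley₁ = to T-∧ (valleys 1 (s≤s z≤n) (s≤s (s≤s z≤n)))

valleyTest : List ℕ → ℕ → Bool
valleyTest σ j = if 2 *ℕ j ≤ᵇ length σ ∸ 1 then valleyAt σ (2 *ℕ j) else true

isAlt⇔EvenValleys : ∀ σ {n} → length σ ≡ n → evenᵇ n ≡ false → T (isAlt n σ) ⇔ EvenValleys σ
isAlt⇔EvenValleys σ refl odd rewrite odd | ∧-identityʳ (all (valleyTest σ) (range1 (length σ))) = mk⇔ alt⇒valleys valleys⇒alt
  where
  n = length σ
  alt⇒valleys : T (all (valleyTest σ) (range1 n)) → EvenValleys σ
  alt⇒valleys allTests j 1≤j 2j≤ = subst (λ b → T (if b then valleyAt σ (2 *ℕ j) else true)) (≤ᵇ-true 2j≤)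
    (All.lookup (All.all⁺ (valleyTest σ) (range1 n) allTests) (∈-range1⁺ (1≤j , j≤n)))
    where
    j≤n : j ≤ n
    j≤n = ℕ.≤-trans (ℕ.m≤m+n j (j +ℕ 0)) (ℕ.≤-trans 2j≤ (ℕ.m∸n≤m n 1))
  valleys⇒alt : EvenValleys σ → T (all (valleyTest σ) (range1 n))
  valleys⇒alt valleys = All.all⁻ (valleyTest σ) (All.tabulate test)
    where
    test : ∀ {j} → j ∈ range1 n → T (valleyTest σ j)
    test {j} j∈ with 2 *ℕ j ≤ᵇ n ∸ 1 in eq
    ... | true  = valleys j (proj₁ (∈-range1⁻ j∈)) (ℕ.≤ᵇ⇒≤ _ _ (subst T (sym eq) _))
    ... | false = _

DownUp⇔isAlt : ∀ σ {n} → length σ ≡ n → evenᵇ n ≡ false → DownUp σ ⇔ T (isAlt n σ)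
DownUp⇔isAlt σ refl odd =
  mk⇔ (from (isAlt⇔EvenValleys σ refl odd) ∘ DownUp⇒EvenValleys) (EvenValleys⇒DownUp σ odd ∘ to (isAlt⇔EvenValleys σ refl odd))

DownUp-asc : ∀ {σ q} → DownUp σ → length σ ≡ suc (q +ℕ q) → asc σ ≡ q
DownUp-asc {σ} {q} du len≡ = double-injective (asc σ) q (ℕ.suc-injective (trans (sym (DownUp-length du)) len≡))

-- The Eulerian polynomials at -1

fixed? : ∀ n σ → Dec (ι n σ ≡ σ)
fixed? n σ = ≡-dec ℕ._≟_ (ι n σ) σ

A-at-minus-one : ∀ n → A n -1ℤ ≡ ∑ (λ σ → -1ℤ ^ asc σ) (filter (fixed? n) (Sym n))
A-at-minus-one n = trans (A≡∑asc n -1ℤ)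
  (∑-signReversingInvolution (ι n) (fixed? n) (λ σ → -1ℤ ^ asc σ) (Sym-unique n) ι∈ ιι reverses)
  where
  small : ∀ {σ} → σ ∈ Sym n → Small n σ
  small σ∈ = unique (∈-Sym⁻ n σ∈) , ℕ.≤-reflexive (length≡ (∈-Sym⁻ n σ∈))
  ι∈ : ∀ {σ} → σ ∈ Sym n → ι n σ ∈ Sym n
  ι∈ {σ} σ∈ = ∈-Sym⁺ n (IsPerm-resp-↭ (↭-sym (ι-↭ n σ)) (∈-Sym⁻ n σ∈))
  ιι : ∀ {σ} → σ ∈ Sym n → ι n (ι n σ) ≡ σ
  ιι {σ} σ∈ = ι-involutive n σ (small σ∈)
  reverses : ∀ {σ} → σ ∈ Sym n → ι n σ ≢ σ → -1ℤ ^ asc (ι n σ) ≡ - (-1ℤ ^ asc σ)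
  reverses {σ} σ∈ moved = -1^-Odd (asc (ι n σ)) (asc σ) (ι-changes-parity n σ (small σ∈) moved)

fixed⇔DownUp : ∀ n {σ} → σ ∈ Sym (suc n) → ι (suc n) σ ≡ σ ⇔ DownUp σ
fixed⇔DownUp n {σ} σ∈ = mk⇔ (fixed⇒DownUp (suc n) σ small nonempty) (DownUp⇒fixed (suc n) σ small)
  where
  σ-perm = ∈-Sym⁻ (suc n) σ∈
  small = unique σ-perm , ℕ.≤-reflexive (length≡ σ-perm)
  nonempty : σ ≢ []
  nonempty refl = ℕ.1+n≢0 (sym (length≡ σ-perm))

A-even-at-minus-one : ∀ n → evenᵇ (suc n) ≡ true → A (suc n) -1ℤ ≡ + 0
A-even-at-minus-one n even = trans (A-at-minus-one (suc n))
  (cong (∑ (λ σ → -1ℤ ^ asc σ)) (filter-none (fixed? (suc n)) (All.tabulate noFixedPoint)))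
  where
  noFixedPoint : ∀ {σ} → σ ∈ Sym (suc n) → ι (suc n) σ ≢ σ
  noFixedPoint σ∈ fixed = true≢false (trans (sym even)
    (trans (cong evenᵇ (sym (length≡ (∈-Sym⁻ (suc n) σ∈)))) (DownUp-odd (to (fixed⇔DownUp n σ∈) fixed))))

A-odd-at-minus-one : ∀ q → -1ℤ ^ q * A (suc (q +ℕ q)) -1ℤ ≡ + length (Alt (suc (q +ℕ q)))
A-odd-at-minus-one q = begin
  -1ℤ ^ q * A N -1ℤ                                            ≡⟨ cong (_*_ (-1ℤ ^ q)) (A-at-minus-one N) ⟩
  -1ℤ ^ q * ∑ (λ σ → -1ℤ ^ asc σ) (filter (fixed? N) (Sym N))  ≡⟨ cong (λ l → -1ℤ ^ q * ∑ (λ σ → -1ℤ ^ asc σ) l) fixed≡Alt ⟩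
  -1ℤ ^ q * ∑ (λ σ → -1ℤ ^ asc σ) (Alt N)                      ≡⟨ *-distribˡ-∑ (-1ℤ ^ q) _ (Alt N) ⟩
  ∑ (λ σ → -1ℤ ^ q * -1ℤ ^ asc σ) (Alt N)                      ≡⟨ ∑-cong (Alt N) term≡1 ⟩
  ∑ (λ _ → + 1) (Alt N)                                        ≡⟨ ∑-one (Alt N) ⟩
  + length (Alt N)                                             ∎
  where
  open ≡-Reasoning
  N = suc (q +ℕ q)
  N-odd : evenᵇ N ≡ false
  N-odd = evenᵇ-odd (q , refl)
  fixed≡Alt : filter (fixed? N) (Sym N) ≡ Alt N
  fixed≡Alt = filter-cong-∈ (fixed? N) (T? ∘ isAlt N) (Sym N)
    (λ {σ} σ∈ → ⇔-trans (fixed⇔DownUp (q +ℕ q) σ∈) (DownUp⇔isAlt σ (length≡ (∈-Sym⁻ N σ∈)) N-odd))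
  term≡1 : ∀ {σ} → σ ∈ Alt N → -1ℤ ^ q * -1ℤ ^ asc σ ≡ + 1
  term≡1 {σ} σ∈ with ∈.∈-filter⁻ (T? ∘ isAlt N) {xs = Sym N} σ∈
  ... | σ∈Sym , alt = begin
    -1ℤ ^ q * -1ℤ ^ asc σ  ≡⟨ cong (λ k → -1ℤ ^ q * -1ℤ ^ k) (DownUp-asc {q = q} (from (DownUp⇔isAlt σ len≡ N-odd) alt) len≡) ⟩
    -1ℤ ^ q * -1ℤ ^ q      ≡⟨ ℤ.^-distribˡ-+-* -1ℤ q q ⟨
    -1ℤ ^ (q +ℕ q)         ≡⟨ -1^-double q ⟩
    + 1                    ∎
    where len≡ = length≡ (∈-Sym⁻ N σ∈Sym)

eulerian-at-minus-one : ∀ (p : ℕ) → 1 ≤ p →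
                        (A (2 *ℕ p) -1ℤ ≡ + 0)
                        × (-1ℤ ^ (p ∸ 1) * A (2 *ℕ p ∸ 1) -1ℤ ≡ + length (Alt (2 *ℕ p ∸ 1)))
eulerian-at-minus-one (suc q) _ =
  A-even-at-minus-one (q +ℕ suc (q +ℕ 0)) (subst (λ k → evenᵇ k ≡ true) 2[1+q]≡ (evenᵇ-double (suc q))) ,
  subst (λ N → -1ℤ ^ q * A N -1ℤ ≡ + length (Alt N)) 1+2q≡ (A-odd-at-minus-one q)
  where
  1+2q≡ : suc (q +ℕ q) ≡ q +ℕ suc (q +ℕ 0)
  1+2q≡ = trans (sym (ℕ.+-suc q q)) (cong (λ k → q +ℕ suc k) (sym (ℕ.+-identityʳ q)))
  2[1+q]≡ : suc q +ℕ suc q ≡ suc (q +ℕ suc (q +ℕ 0))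
  2[1+q]≡ = cong (λ k → suc (q +ℕ suc k)) (sym (ℕ.+-identityʳ q))

mainTheorem19 :
    (∀ (n : ℕ) → 2 ≤ n → (c : ℕ → ℤ) → IsExpansion n c →
       ∀ (t : ℤ) → t * A (n ∸ 1) t ≡ sumK n (λ k → c k * t ^ k * (+ 1 + t) ^ (n ∸ 2 *ℕ k)))
    ×
    (∀ (p : ℕ) → 1 ≤ p →
       (A (2 *ℕ p) -1ℤ ≡ + 0)
       × (-1ℤ ^ (p ∸ 1) * A (2 *ℕ p ∸ 1) -1ℤ ≡ + length (Alt (2 *ℕ p ∸ 1))))
mainTheorem19 = eulerian-expansion , eulerian-at-minus-one
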